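{- Let $k, c, r$ be integers such that $k \geq 1$, $r \geq 2k$, $c \equiv 0 \pmod 3$ and $\frac{3(k-2)(k-1)}{2} \leq c \leq \frac{3k(k-1)}{2}$. Then there exists an $(r,c)$-circulant.
   Context: All graphs are finite and simple. For a vertex $v$, $e(v)$ denotes the number of edges of the subgraph induced by the open neighbourhood of $v$. An $(r,c)$-graph is an $r$-regular graph with $e(v) = c$ for every vertex $v$. For $n \geq 2$ and $S \subseteq \{1, \dots, \lfloor n/2 \rfloor\}$, $\mathsf{Circ}(n,S)$ is the Cayley graph of $\mathbb{Z}_n$ with connection set $S \cup -S$. An $(r,c)$-circulant is a graph $\mathsf{Circ}(n,S)$ (for some $n$, $S$) that is an $(r,c)$-graph. -}

module Defs where

open import Data.Nat using (ℕ; zero; suc; _+_; _*_; _∸_; _≤_; _<_; _<ᵇ_; _≡ᵇ_; _/_; _%_; NonZero)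
open import Data.Bool using (Bool; true; false; _∧_; _∨_; if_then_else_)
open import Data.List using (List; allFin; map)
open import Data.Nat.ListAction using (sum)
open import Data.Bool.ListAction using (any)
open import Data.List.Relation.Unary.All using (All)
open import Data.Fin using (Fin; toℕ)
open import Data.Product using (_×_; Σ)
open import Relation.Binary.PropositionalEquality using (_≡_)

count : (n : ℕ) → (Fin n → Bool) → ℕ
count n p = sum (map (λ i → if p i then 1 else 0) (allFin n))

-- A valid connection set: S ⊆ {1, …, ⌊n/2⌋} (given as a list; duplicates are harmless).
ValidConn : (n : ℕ) → .{{NonZero n}} → List ℕ → Set
ValidConn n S = All (λ s → (1 ≤ s) × (s ≤ n / 2)) S

-- Adjacency in Circ(n,S), the Cayley graph of ℤ_n with connection set S ∪ -S:
-- x ~ y  iff  y = x + s (mod n)  or  x = y + s (mod n)  for some s ∈ S.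
circAdj : (n : ℕ) → .{{NonZero n}} → List ℕ → Fin n → Fin n → Bool
circAdj n S x y =
  any (λ s → (((toℕ x + s) % n) ≡ᵇ toℕ y) ∨ (((toℕ y + s) % n) ≡ᵇ toℕ x)) S

circDeg : (n : ℕ) → .{{NonZero n}} → List ℕ → Fin n → ℕ
circDeg n S v = count n (λ y → circAdj n S v y)

-- e(v): number of edges of the subgraph induced by the open neighbourhood of v,
-- i.e. the number of unordered pairs {a,b} (counted as a < b) with a, b ∈ N(v) and a ~ b.
circE : (n : ℕ) → .{{NonZero n}} → List ℕ → Fin n → ℕ
circE n S v =
  sum (map (λ a → count n (λ b →
    (toℕ a <ᵇ toℕ b) ∧ circAdj n S v a ∧ circAdj n S v b ∧ circAdj n S a b))
    (allFin n))

IsRCCirc : (n : ℕ) → .{{NonZero n}} → List ℕ → ℕ → ℕ → Set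
IsRCCirc n S r c = (v : Fin n) → (circDeg n S v ≡ r) × (circE n S v ≡ c)

-- There exists an (r,c)-circulant: some Circ(n,S) with n ≥ 2 (written n = 2 + m)
-- and S ⊆ {1,…,⌊n/2⌋} that is an (r,c)-graph.
RCCirculantExists : ℕ → ℕ → Set
RCCirculantExists r c =
  Σ ℕ λ m → Σ (List ℕ) λ S → ValidConn (2 + m) S × IsRCCirc (2 + m) S r c

-- Write the statement's k as k + 1 and c as 3 (C(k,2) + j) with 0 ≤ j ≤ k. If D lists distinct non-zero
-- residues and D = S ∪ −S, then Circ(n, S) is |D|-regular and 2 e(v) is the number of ordered pairs
-- (d₁, d₂) ∈ D² with d₂ − d₁ ∈ D. For P = {1,…,k} ∪ {2k + 1 − j} and K = 4m + 2, where m = max P, no relation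
-- among the elements of ±P wraps around ℤ_K, so each ordered pair (a, b) ∈ P² with a + b ∈ P accounts for six
-- such pairs; there are C(k,2) + j of them, hence Circ(K, P) is a (2k + 2, c)-graph. To reach degree
-- r = 2k + 2 + 2t + b, scale by g = 2t + 1 to n = K g and add the 2t + b residues of the window N ± t around
-- N = n/2 (N itself iff b = 1). The scaled ±P lies in the arcs [g, m g] and [(3m + 2) g, (4m + 1) g]; a
-- relation x + d = y involving the window is a zero-sum triple (x, d, −y) whose sum falls strictly between
-- two consecutive multiples of n, so the window adds degree but no edges inside neighbourhoods.

{-# OPTIONS --safe #-}
module Submission where

open import Defs
open import Data.Nat
open import Data.Nat.Divisibility using (_∣_; divides)
open import Data.Nat.Properties
open import Data.Nat.DivMod
open import Data.Nat.Combinatorics using (_C_; nC1≡n; nCk+nC[k+1]≡[n+1]C[k+1])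
open import Data.Nat.ListAction using (sum)
open import Data.Nat.ListAction.Properties using (sum-++)
open import Data.Nat.Tactic.RingSolver using (solve-∀)
open import Data.Bool using (Bool; true; false; T; _∧_; _∨_; if_then_else_)
open import Data.Bool.Properties
  using (∨-comm; ∨-assoc; ∨-identityʳ; ∧-zeroʳ; ∧-assoc; ∧-comm; ∨-commutativeMonoid; ∨-idempotentCommutativeMonoid)
open import Data.Bool.ListAction using (any; or)
open import Data.List using (List; []; _∷_; _++_; map; length; allFin; tabulate)
open import Data.List.Properties
  using (map-++; map-∘; map-cong; map-cong-local; length-map; length-++; map-tabulate; tabulate-cong)
open import Data.List.Relation.Unary.All as All using (All; []; _∷_)
open import Data.List.Relation.Unary.All.Properties as All using ()
open import Data.List.Relation.Unary.AllPairs using ([]; _∷_)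
open import Data.List.Relation.Unary.Unique.Propositional using (Unique)
open import Data.List.Relation.Unary.Unique.Propositional.Properties as Unique using ()
open import Data.List.Relation.Binary.Disjoint.Propositional using (Disjoint)
open import Data.Fin using (Fin; toℕ)
open import Data.Fin.Properties using (toℕ<n)
open import Data.Product using (_×_; _,_; proj₁; proj₂; Σ)
open import Data.Sum using (_⊎_; inj₁; inj₂; [_,_]′)
open import Data.Unit using (tt)
open import Data.Empty using (⊥; ⊥-elim)
open import Function using (_∘_)
open import Relation.Nullary using (¬_; contradiction)
open import Relation.Binary using (tri<; tri≈; tri>)
open import Relation.Binary.PropositionalEquality
open import Algebra.Bundles using (CommutativeMonoid)
open import Algebra.Properties.CommutativeSemigroup +-commutativeSemigroup using (interchange)
open import Algebra.Properties.CommutativeSemigroup (CommutativeMonoid.commutativeSemigroup ∨-commutativeMonoid)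
  using () renaming (interchange to ∨-interchange)
import Algebra.Solver.IdempotentCommutativeMonoid ∨-idempotentCommutativeMonoid as ICM

∑ : List ℕ → (ℕ → ℕ) → ℕ
∑ xs f = sum (map f xs)

syntax ∑ xs (λ x → e) = ∑[ x ∈ xs ] e

module _ {P : ℕ → Set} where

  ∑-cong-on : ∀ {xs} {f g : ℕ → ℕ} → All P xs → (∀ {x} → P x → f x ≡ g x) → ∑ xs f ≡ ∑ xs g
  ∑-cong-on []         eq = refl
  ∑-cong-on (px ∷ pxs) eq = cong₂ _+_ (eq px) (∑-cong-on pxs eq)

  ∑-≡0-on : ∀ {xs} {f : ℕ → ℕ} → All P xs → (∀ {x} → P x → f x ≡ 0) → ∑ xs f ≡ 0
  ∑-≡0-on []         eq = refl
  ∑-≡0-on (px ∷ pxs) eq = cong₂ _+_ (eq px) (∑-≡0-on pxs eq)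

∑-cong : ∀ xs {f g : ℕ → ℕ} → (∀ x → f x ≡ g x) → ∑ xs f ≡ ∑ xs g
∑-cong xs eq = cong sum (map-cong eq xs)

∑-++ : ∀ xs ys (f : ℕ → ℕ) → ∑ (xs ++ ys) f ≡ ∑ xs f + ∑ ys f
∑-++ xs ys f = trans (cong sum (map-++ f xs ys)) (sum-++ (map f xs) (map f ys))

∑-map : ∀ (g : ℕ → ℕ) xs (f : ℕ → ℕ) → ∑ (map g xs) f ≡ ∑[ x ∈ xs ] f (g x)
∑-map g xs f = cong sum (sym (map-∘ xs))

∑-const : ∀ xs c → ∑[ _ ∈ xs ] c ≡ length xs * c
∑-const []       c = refl
∑-const (x ∷ xs) c = cong (c +_) (∑-const xs c)

∑-zero : ∀ xs → ∑[ _ ∈ xs ] 0 ≡ 0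
∑-zero xs = trans (∑-const xs 0) (*-zeroʳ (length xs))

∑-distrib-+ : ∀ xs (f g : ℕ → ℕ) → ∑[ x ∈ xs ] (f x + g x) ≡ ∑ xs f + ∑ xs g
∑-distrib-+ []       f g = refl
∑-distrib-+ (x ∷ xs) f g =
  trans (cong (f x + g x +_) (∑-distrib-+ xs f g)) (interchange (f x) (g x) (∑ xs f) (∑ xs g))

∑-comm : ∀ xs ys (f : ℕ → ℕ → ℕ) → ∑[ x ∈ xs ] ∑ ys (f x) ≡ ∑[ y ∈ ys ] ∑[ x ∈ xs ] f x y
∑-comm []       ys f = sym (∑-zero ys)
∑-comm (x ∷ xs) ys f =
  trans (cong (∑ ys (f x) +_) (∑-comm xs ys f)) (sym (∑-distrib-+ ys (f x) _))

m+m≡m*2 : ∀ m → m + m ≡ m * 2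
m+m≡m*2 m = trans (cong (m +_) (sym (+-identityʳ m))) (*-comm 2 m)

range : ℕ → ℕ → List ℕ
range s zero    = []
range s (suc l) = s ∷ range (suc s) l

length-range : ∀ s l → length (range s l) ≡ l
length-range s zero    = refl
length-range s (suc l) = cong suc (length-range (suc s) l)

range-++ : ∀ s a b → range s (a + b) ≡ range s a ++ range (s + a) b
range-++ s zero    b = cong (λ s′ → range s′ b) (sym (+-identityʳ s))
range-++ s (suc a) b = cong (s ∷_) (trans (range-++ (suc s) a b) (cong (λ s′ → range (suc s) a ++ range s′ b) (sym (+-suc s a))))

range-bounds : ∀ s l → All (λ x → s ≤ x × x < s + l) (range s l)
range-bounds s zero    = []
range-bounds s (suc l) =
  (≤-refl , subst (s <_) (sym (+-suc s l)) (s<s (m≤m+n s l))) ∷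
  All.map (λ {x} (s<x , x<) → <⇒≤ s<x , subst (x <_) (sym (+-suc s l)) x<) (range-bounds (suc s) l)

range-unique : ∀ s l → Unique (range s l)
range-unique s zero    = []
range-unique s (suc l) = All.map (λ (s<x , _) → <⇒≢ s<x) (range-bounds (suc s) l) ∷ range-unique (suc s) l

map-+-range : ∀ a s l → map (a +_) (range s l) ≡ range (a + s) l
map-+-range a s zero    = refl
map-+-range a s (suc l) = cong (a + s ∷_) (trans (map-+-range a (suc s) l) (cong (λ z → range z l) (+-suc a s)))

disjoint-by : ∀ {P Q : ℕ → Set} {xs ys} → All P xs → All Q ys → (∀ {x} → P x → Q x → ⊥) → Disjoint xs ys
disjoint-by pxs qys excl (x∈xs , x∈ys) = excl (All.lookup pxs x∈xs) (All.lookup qys x∈ys)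

Unique-map-on : ∀ {P : ℕ → Set} {f : ℕ → ℕ} {xs} → (∀ {x y} → P x → P y → f x ≡ f y → x ≡ y) →
                All P xs → Unique xs → Unique (map f xs)
Unique-map-on inj []         []          = []
Unique-map-on inj (px ∷ pxs) (x∉ ∷ uniq) =
  All.map⁺ (All.zipWith (λ (py , x≢y) fx≡fy → x≢y (inj px py fx≡fy)) (pxs , x∉)) ∷ Unique-map-on inj pxs uniq

⟦_⟧ : Bool → ℕ
⟦ b ⟧ = if b then 1 else 0

_∈ᵇ_ : ℕ → List ℕ → Bool
a ∈ᵇ xs = any (λ x → x ≡ᵇ a) xs

⇔T⇒≡ : ∀ {a b} → (T a → T b) → (T b → T a) → a ≡ b
⇔T⇒≡ {false} {false} _ _ = refl
⇔T⇒≡ {false} {true}  _ g = ⊥-elim (g tt)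
⇔T⇒≡ {true}  {false} f _ = ⊥-elim (f tt)
⇔T⇒≡ {true}  {true}  _ _ = refl

≡ᵇ-cong-⇔ : ∀ {x y u v} → (x ≡ y → u ≡ v) → (u ≡ v → x ≡ y) → (x ≡ᵇ y) ≡ (u ≡ᵇ v)
≡ᵇ-cong-⇔ {x} {y} {u} {v} f g =
  ⇔T⇒≡ (λ p → ≡⇒≡ᵇ u v (f (≡ᵇ⇒≡ x y p))) (λ p → ≡⇒≡ᵇ x y (g (≡ᵇ⇒≡ u v p)))

≡ᵇ-true : ∀ {x y} → x ≡ y → (x ≡ᵇ y) ≡ true
≡ᵇ-true {x} {y} x≡y = ⇔T⇒≡ _ (λ _ → ≡⇒≡ᵇ x y x≡y)

≡ᵇ-false : ∀ {x y} → x ≢ y → (x ≡ᵇ y) ≡ false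
≡ᵇ-false {x} {y} x≢y = ⇔T⇒≡ (λ p → x≢y (≡ᵇ⇒≡ x y p)) λ ()

≡ᵇ-sym : ∀ x y → (x ≡ᵇ y) ≡ (y ≡ᵇ x)
≡ᵇ-sym x y = ≡ᵇ-cong-⇔ {x} {y} {y} {x} sym sym

<ᵇ-true : ∀ {x y} → x < y → (x <ᵇ y) ≡ true
<ᵇ-true x<y = ⇔T⇒≡ _ (λ _ → <⇒<ᵇ x<y)

<ᵇ-false : ∀ {x y} → ¬ x < y → (x <ᵇ y) ≡ false
<ᵇ-false {x} {y} x≮y = ⇔T⇒≡ (λ p → x≮y (<ᵇ⇒< x y p)) λ ()

module _ {P : ℕ → Set} where

  any-cong-on : ∀ {xs} {p q : ℕ → Bool} → All P xs → (∀ {x} → P x → p x ≡ q x) → any p xs ≡ any q xs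
  any-cong-on []         eq = refl
  any-cong-on (px ∷ pxs) eq = cong₂ _∨_ (eq px) (any-cong-on pxs eq)

  any-false-on : ∀ {xs} {p : ℕ → Bool} → All P xs → (∀ {x} → P x → p x ≡ false) → any p xs ≡ false
  any-false-on []         eq = refl
  any-false-on (px ∷ pxs) eq = cong₂ _∨_ (eq px) (any-false-on pxs eq)

any-cong : ∀ xs {p q : ℕ → Bool} → (∀ x → p x ≡ q x) → any p xs ≡ any q xs
any-cong xs eq = cong or (map-cong eq xs)

any-++ : ∀ (p : ℕ → Bool) xs ys → any p (xs ++ ys) ≡ any p xs ∨ any p ys
any-++ p []       ys = refl
any-++ p (x ∷ xs) ys = trans (cong (p x ∨_) (any-++ p xs ys)) (sym (∨-assoc (p x) _ _))

any-map : ∀ (p : ℕ → Bool) (g : ℕ → ℕ) xs → any p (map g xs) ≡ any (λ x → p (g x)) xs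
any-map p g xs = cong or (sym (map-∘ xs))

any-∨ : ∀ (p q : ℕ → Bool) xs → any (λ x → p x ∨ q x) xs ≡ any p xs ∨ any q xs
any-∨ p q []       = refl
any-∨ p q (x ∷ xs) = trans (cong ((p x ∨ q x) ∨_) (any-∨ p q xs)) (∨-interchange (p x) (q x) (any p xs) (any q xs))

if-false : ∀ {b} {u : ℕ} → b ≡ false → (if b then u else 0) ≡ 0
if-false refl = refl

if-∨ : ∀ b c (u : ℕ) → (b ≡ true → c ≡ false) →
       (if b ∨ c then u else 0) ≡ (if b then u else 0) + (if c then u else 0)
if-∨ true  c u excl rewrite excl refl = sym (+-identityʳ u)
if-∨ false c u excl = refl

⟦∧⟧ : ∀ a b → ⟦ a ∧ b ⟧ ≡ (if a then ⟦ b ⟧ else 0)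
⟦∧⟧ true  b = refl
⟦∧⟧ false b = refl

∑-if : ∀ xs a (f : ℕ → ℕ) → ∑[ x ∈ xs ] (if a then f x else 0) ≡ (if a then ∑ xs f else 0)
∑-if xs true  f = refl
∑-if xs false f = ∑-zero xs

⟦any⟧≡∑ : ∀ {p : ℕ → Bool} {xs} → Unique xs → (∀ {x y} → T (p x) → T (p y) → x ≡ y) →
          ⟦ any p xs ⟧ ≡ ∑[ x ∈ xs ] ⟦ p x ⟧
⟦any⟧≡∑ {p} {[]}     []          at-most-one = refl
⟦any⟧≡∑ {p} {x ∷ xs} (x∉ ∷ uniq) at-most-one with p x in px
... | true  = sym (cong suc (∑-≡0-on x∉ (λ x≢y → if-false (⇔T⇒≡ (λ py → x≢y (at-most-one px′ py)) λ ()))))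
  where
  px′ : T (p x)
  px′ = subst T (sym px) tt
... | false = ⟦any⟧≡∑ uniq at-most-one

⟦∈ᵇ⟧≡∑ : ∀ {z xs} → Unique xs → ⟦ z ∈ᵇ xs ⟧ ≡ ∑[ c ∈ xs ] ⟦ c ≡ᵇ z ⟧
⟦∈ᵇ⟧≡∑ {z} uniq = ⟦any⟧≡∑ uniq (λ {c} {c′} p q → trans (≡ᵇ⇒≡ c z p) (sym (≡ᵇ⇒≡ c′ z q)))

∑-range-≡ᵇ-out : ∀ x s l (g : ℕ → ℕ) → x < s ⊎ s + l ≤ x →
                 ∑[ a ∈ range s l ] (if x ≡ᵇ a then g a else 0) ≡ 0
∑-range-≡ᵇ-out x s l g outside = ∑-≡0-on (range-bounds s l) λ (s≤a , a<) → if-false (≡ᵇ-false (x≢ s≤a a< outside))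
  where
  x≢ : ∀ {a} → s ≤ a → a < s + l → x < s ⊎ s + l ≤ x → x ≢ a
  x≢ s≤a a< (inj₁ x<s)  refl = <⇒≱ x<s s≤a
  x≢ s≤a a< (inj₂ s+l≤) refl = <⇒≱ a< s+l≤

∑-range-≡ᵇ : ∀ x s l (g : ℕ → ℕ) → s ≤ x → x < s + l →
             ∑[ a ∈ range s l ] (if x ≡ᵇ a then g a else 0) ≡ g x
∑-range-≡ᵇ x s zero    g s≤x x< = ⊥-elim (<⇒≱ x< (subst (_≤ x) (sym (+-identityʳ s)) s≤x))
∑-range-≡ᵇ x s (suc l) g s≤x x< with m≤n⇒m<n∨m≡n s≤x
... | inj₂ refl rewrite ≡ᵇ-true {x} refl =
  trans (cong (g x +_) (∑-range-≡ᵇ-out x (suc x) l g (inj₁ ≤-refl))) (+-identityʳ (g x))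
... | inj₁ s<x rewrite ≡ᵇ-false {x} {s} (≢-sym (<⇒≢ s<x)) =
  ∑-range-≡ᵇ x (suc s) l g s<x (subst (x <_) (+-suc s l) x<)

⟦∈ᵇrange⟧ : ∀ {z} s l → s ≤ z → z < s + l → ⟦ z ∈ᵇ range s l ⟧ ≡ 1
⟦∈ᵇrange⟧ {z} s l s≤z z< = begin
  ⟦ z ∈ᵇ range s l ⟧                       ≡⟨ ⟦∈ᵇ⟧≡∑ (range-unique s l) ⟩
  ∑[ c ∈ range s l ] ⟦ c ≡ᵇ z ⟧            ≡⟨ ∑-cong (range s l) (λ c → cong ⟦_⟧ (≡ᵇ-sym c z)) ⟩
  ∑[ c ∈ range s l ] ⟦ z ≡ᵇ c ⟧            ≡⟨ ∑-range-≡ᵇ z s l (λ _ → 1) s≤z z< ⟩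
  1                                         ∎
  where open ≡-Reasoning

∈ᵇrange-out : ∀ {z} s l → s + l ≤ z → z ∈ᵇ range s l ≡ false
∈ᵇrange-out {z} s l s+l≤z = any-false-on (range-bounds s l) λ (_ , c<) → ≡ᵇ-false λ c≡z →
  <⇒≱ c< (subst (s + l ≤_) (sym c≡z) s+l≤z)

∑-range-∈ᵇ : ∀ n {ys} → Unique ys → All (_< n) ys → (g : ℕ → ℕ) →
             ∑[ a ∈ range 0 n ] (if a ∈ᵇ ys then g a else 0) ≡ ∑ ys g
∑-range-∈ᵇ n {[]}    []            []          g = ∑-zero (range 0 n)
∑-range-∈ᵇ n {x ∷ ys} (x∉ys ∷ ys-uniq) (x<n ∷ ys<n) g = begin
  ∑[ a ∈ range 0 n ] (if (x ≡ᵇ a) ∨ (a ∈ᵇ ys) then g a else 0)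
    ≡⟨ ∑-cong (range 0 n) (λ a → if-∨ (x ≡ᵇ a) (a ∈ᵇ ys) (g a) (x∈ᵇ⇒∉ a)) ⟩
  ∑[ a ∈ range 0 n ] ((if x ≡ᵇ a then g a else 0) + (if a ∈ᵇ ys then g a else 0))
    ≡⟨ ∑-distrib-+ (range 0 n) _ _ ⟩
  ∑[ a ∈ range 0 n ] (if x ≡ᵇ a then g a else 0) + ∑[ a ∈ range 0 n ] (if a ∈ᵇ ys then g a else 0)
    ≡⟨ cong₂ _+_ (∑-range-≡ᵇ x 0 n g z≤n x<n) (∑-range-∈ᵇ n ys-uniq ys<n g) ⟩
  g x + ∑ ys g ∎
  where
  open ≡-Reasoning
  x∈ᵇ⇒∉ : ∀ a → (x ≡ᵇ a) ≡ true → (a ∈ᵇ ys) ≡ false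
  x∈ᵇ⇒∉ a x≡ᵇa with ≡ᵇ⇒≡ x a (subst T (sym x≡ᵇa) tt)
  ... | refl = any-false-on x∉ys (λ x≢t → ≡ᵇ-false (≢-sym x≢t))

sum-allFin : ∀ n (f : ℕ → ℕ) → sum (map (λ i → f (toℕ i)) (allFin n)) ≡ ∑ (range 0 n) f
sum-allFin n f = trans (cong sum (map-tabulate {n = n} (λ i → i) (λ i → f (toℕ i)))) (shifted n 0)
  where
  shifted : ∀ n s → sum (tabulate {n = n} (λ i → f (s + toℕ i))) ≡ ∑ (range s n) f
  shifted zero    s = refl
  shifted (suc n) s = cong₂ _+_ (cong f (+-identityʳ s))
    (trans (cong sum (tabulate-cong {n = n} (λ i → cong f (+-suc s (toℕ i))))) (shifted n (suc s)))

module _ {P : ℕ → Set} (h : ℕ → ℕ → Bool)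
         (h-sym : ∀ {x y} → P x → P y → h x y ≡ h y x) (h-irrefl : ∀ {x} → P x → h x x ≡ false) where

  private
    split-by-order : ∀ {x y} → P x → P y → ⟦ h x y ⟧ ≡ ⟦ (x <ᵇ y) ∧ h x y ⟧ + ⟦ (y <ᵇ x) ∧ h y x ⟧
    split-by-order {x} {y} px py with <-cmp x y
    ... | tri< x<y _ y≮x rewrite <ᵇ-true x<y | <ᵇ-false y≮x = sym (+-identityʳ _)
    ... | tri> x≮y _ y<x rewrite <ᵇ-true y<x | <ᵇ-false x≮y = cong ⟦_⟧ (h-sym px py)
    ... | tri≈ x≮y refl _ rewrite <ᵇ-false x≮y | h-irrefl px = refl

  ∑∑-symmetrize : ∀ {xs} → All P xs →
    (∑[ x ∈ xs ] ∑[ y ∈ xs ] ⟦ (x <ᵇ y) ∧ h x y ⟧) * 2 ≡ ∑[ x ∈ xs ] ∑[ y ∈ xs ] ⟦ h x y ⟧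
  ∑∑-symmetrize {xs} pxs = sym (begin
    ∑[ x ∈ xs ] ∑[ y ∈ xs ] ⟦ h x y ⟧
      ≡⟨ ∑-cong-on pxs (λ px → ∑-cong-on pxs (λ py → split-by-order px py)) ⟩
    ∑[ x ∈ xs ] ∑[ y ∈ xs ] (H x y + H y x)
      ≡⟨ ∑-cong xs (λ x → ∑-distrib-+ xs (H x) (λ y → H y x)) ⟩
    ∑[ x ∈ xs ] (∑ xs (H x) + ∑[ y ∈ xs ] H y x)
      ≡⟨ ∑-distrib-+ xs _ _ ⟩
    ∑[ x ∈ xs ] ∑ xs (H x) + ∑[ x ∈ xs ] ∑[ y ∈ xs ] H y x
      ≡⟨ cong (∑[ x ∈ xs ] ∑ xs (H x) +_) (∑-comm xs xs (λ x y → H y x)) ⟩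
    ∑[ x ∈ xs ] ∑ xs (H x) + ∑[ x ∈ xs ] ∑ xs (H x)
      ≡⟨ m+m≡m*2 (∑[ x ∈ xs ] ∑ xs (H x)) ⟩
    ∑[ x ∈ xs ] ∑ xs (H x) * 2 ∎)
    where
    open ≡-Reasoning
    H : ℕ → ℕ → ℕ
    H x y = ⟦ (x <ᵇ y) ∧ h x y ⟧

module _ {n : ℕ} .{{_ : NonZero n}} where

  [m%n+o]%n≡[m+o]%n : ∀ m o → (m % n + o) % n ≡ (m + o) % n
  [m%n+o]%n≡[m+o]%n m o = begin
    (m % n + o) % n           ≡⟨ %-distribˡ-+ (m % n) o n ⟩
    (m % n % n + o % n) % n   ≡⟨ cong (λ z → (z + o % n) % n) (m%n%n≡m%n m n) ⟩
    (m % n + o % n) % n       ≡⟨ sym (%-distribˡ-+ m o n) ⟩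
    (m + o) % n               ∎
    where open ≡-Reasoning

  [m+o]%n≡[m+p]%n⇒o%n≡p%n : ∀ m o p → (m + o) % n ≡ (m + p) % n → o % n ≡ p % n
  [m+o]%n≡[m+p]%n⇒o%n≡p%n m o p eq = trans (via o) (trans (cong (λ z → (z + m * pred n) % n) eq) (sym (via p)))
    where
    open ≡-Reasoning
    via : ∀ o → o % n ≡ ((m + o) % n + m * pred n) % n
    via o = begin
      o % n                          ≡⟨ sym ([m+kn]%n≡m%n o m n) ⟩
      (o + m * n) % n                ≡⟨ cong (λ n′ → (o + m * n′) % n) (sym (suc-pred n)) ⟩
      (o + m * suc (pred n)) % n     ≡⟨ cong (_% n) (rearrange m o (pred n)) ⟩
      (m + o + m * pred n) % n       ≡⟨ sym ([m%n+o]%n≡[m+o]%n (m + o) (m * pred n)) ⟩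
      ((m + o) % n + m * pred n) % n ∎
      where
      rearrange : ∀ m o p → o + m * suc p ≡ m + o + m * p
      rearrange = solve-∀

  [u+a]%n≡v⇒[v+b]%n≡u%n : ∀ {u v a b} → a + b ≡ n → (u + a) % n ≡ v → (v + b) % n ≡ u % n
  [u+a]%n≡v⇒[v+b]%n≡u%n {u} {v} {a} {b} a+b≡n eq = begin
    (v + b) % n             ≡⟨ cong (λ z → (z + b) % n) (sym eq) ⟩
    ((u + a) % n + b) % n   ≡⟨ [m%n+o]%n≡[m+o]%n (u + a) b ⟩
    (u + a + b) % n         ≡⟨ cong (_% n) (trans (+-assoc u a b) (cong (u +_) a+b≡n)) ⟩
    (u + n) % n             ≡⟨ [m+n]%n≡m%n u n ⟩
    u % n                   ∎
    where open ≡-Reasoning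

  ≡ᵇ-%-negate : ∀ {x y s} → x < n → y < n → s ≤ n → ((x + (n ∸ s)) % n ≡ᵇ y) ≡ ((y + s) % n ≡ᵇ x)
  ≡ᵇ-%-negate x<n y<n s≤n = ≡ᵇ-cong-⇔
    (λ eq → trans ([u+a]%n≡v⇒[v+b]%n≡u%n (m∸n+n≡m s≤n) eq) (m<n⇒m%n≡m x<n))
    (λ eq → trans ([u+a]%n≡v⇒[v+b]%n≡u%n (m+[n∸m]≡n s≤n) eq) (m<n⇒m%n≡m y<n))

_∈[_,_] : ℕ → ℕ → ℕ → Set
x ∈[ lo , hi ] = lo ≤ x × x ≤ hi

∈[]-+ : ∀ {x y a b c d} → x ∈[ a , b ] → y ∈[ c , d ] → (x + y) ∈[ a + c , b + d ]
∈[]-+ (a≤x , x≤b) (c≤y , y≤d) = +-mono-≤ a≤x c≤y , +-mono-≤ x≤b y≤d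

∈[]-negate : ∀ {n x lo hi lo′ hi′} → lo′ + hi ≡ n → hi′ + lo ≡ n → x ∈[ lo , hi ] → (n ∸ x) ∈[ lo′ , hi′ ]
∈[]-negate {n} {x} {lo} {hi} {lo′} {hi′} lo′+hi≡n hi′+lo≡n (lo≤x , x≤hi) =
  subst (_≤ n ∸ x) (trans (cong (_∸ hi) (sym lo′+hi≡n)) (m+n∸n≡m lo′ hi)) (∸-monoʳ-≤ n x≤hi) ,
  subst (n ∸ x ≤_) (trans (cong (_∸ lo) (sym hi′+lo≡n)) (m+n∸n≡m hi′ lo)) (∸-monoʳ-≤ n lo≤x)

<-by-difference : ∀ {x y} z → y ≡ suc (x + z) → x < y
<-by-difference {x} z refl = s≤s (m≤m+n x z)

module _ {n : ℕ} .{{_ : NonZero n}} where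

  %≢0-between : ∀ {s lo hi} q → s ∈[ lo , hi ] → q * n < lo → hi < suc q * n → s % n ≢ 0
  %≢0-between {s} q (lo≤s , s≤hi) qn<lo hi<[1+q]n s%n≡0 =
    <⇒≱ (*-cancelʳ-< _ q (s / n) (subst (q * n <_) s≡[s/n]n (<-≤-trans qn<lo lo≤s)))
        (≤-pred (*-cancelʳ-< _ (s / n) (suc q) (subst (_< suc q * n) s≡[s/n]n (≤-<-trans s≤hi hi<[1+q]n))))
    where
    s≡[s/n]n : s ≡ s / n * n
    s≡[s/n]n = trans (m≡m%n+[m/n]*n s n) (cong (_+ s / n * n) s%n≡0)

-- Circulants as Cayley graphs of ℤ_n

circAdjℕ : (n : ℕ) → .{{NonZero n}} → List ℕ → ℕ → ℕ → Bool
circAdjℕ n S x y = any (λ s → (((x + s) % n) ≡ᵇ y) ∨ (((y + s) % n) ≡ᵇ x)) S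

cayleyAdj : (n : ℕ) → .{{NonZero n}} → List ℕ → ℕ → ℕ → Bool
cayleyAdj n D x y = any (λ d → (x + d) % n ≡ᵇ y) D

linkedPairs : (n : ℕ) → .{{NonZero n}} → List ℕ → ℕ
linkedPairs n D = ∑[ d₁ ∈ D ] ∑[ d₂ ∈ D ] ⟦ cayleyAdj n D d₁ d₂ ⟧

module _ {n : ℕ} .{{_ : NonZero n}} where

  circAdjℕ-sym : ∀ S x y → circAdjℕ n S x y ≡ circAdjℕ n S y x
  circAdjℕ-sym S x y = any-cong S (λ s → ∨-comm ((x + s) % n ≡ᵇ y) ((y + s) % n ≡ᵇ x))

  circAdjℕ≡cayleyAdj : ∀ {S D} → All (_≤ n) S → (∀ p → any p D ≡ any p (S ++ map (n ∸_) S)) →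
                       ∀ {x y} → x < n → y < n → circAdjℕ n S x y ≡ cayleyAdj n D x y
  circAdjℕ≡cayleyAdj {S} {D} S≤n D≈S∪-S {x} {y} x<n y<n = begin
    circAdjℕ n S x y                          ≡⟨ any-∨ α β S ⟩
    any α S ∨ any β S
      ≡⟨ cong (any α S ∨_) (any-cong-on S≤n (λ s≤n → sym (≡ᵇ-%-negate x<n y<n s≤n))) ⟩
    any α S ∨ any (λ s → α (n ∸ s)) S         ≡⟨ cong (any α S ∨_) (sym (any-map α (n ∸_) S)) ⟩
    any α S ∨ any α (map (n ∸_) S)            ≡⟨ sym (any-++ α S _) ⟩
    any α (S ++ map (n ∸_) S)                 ≡⟨ sym (D≈S∪-S α) ⟩
    cayleyAdj n D x y                         ∎
    where
    open ≡-Reasoning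
    α β : ℕ → Bool
    α s = (x + s) % n ≡ᵇ y
    β s = (y + s) % n ≡ᵇ x

module CayleyCount {n : ℕ} .{{_ : NonZero n}} (S D : List ℕ)
  (adj≡ : ∀ {x y} → x < n → y < n → circAdjℕ n S x y ≡ cayleyAdj n D x y)
  (D-unique : Unique D) (D-bounds : All (λ d → 0 < d × d < n) D) where

  private
    R : List ℕ
    R = range 0 n

    R-bounds : All (λ x → 0 ≤ x × x < n) R
    R-bounds = range-bounds 0 n

    C : ℕ → ℕ → Bool
    C = cayleyAdj n D

  neighbours : ℕ → List ℕ
  neighbours v = map (λ d → (v + d) % n) D

  cayleyAdj≡∈ᵇ : ∀ v y → C v y ≡ y ∈ᵇ neighbours v
  cayleyAdj≡∈ᵇ v y = sym (any-map (_≡ᵇ y) (λ d → (v + d) % n) D)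

  neighbours-unique : ∀ v → Unique (neighbours v)
  neighbours-unique v = Unique-map-on translate-injective D-bounds D-unique
    where
    translate-injective : ∀ {d d′} → 0 < d × d < n → 0 < d′ × d′ < n → (v + d) % n ≡ (v + d′) % n → d ≡ d′
    translate-injective (_ , d<n) (_ , d′<n) eq =
      trans (sym (m<n⇒m%n≡m d<n)) (trans ([m+o]%n≡[m+p]%n⇒o%n≡p%n v _ _ eq) (m<n⇒m%n≡m d′<n))

  neighbours-bounded : ∀ v → All (_< n) (neighbours v)
  neighbours-bounded v = All.map⁺ (All.universal (λ d → m%n<n (v + d) n) D)

  ∑-over-neighbours : ∀ v (g : ℕ → ℕ) → ∑[ y ∈ R ] (if C v y then g y else 0) ≡ ∑ (neighbours v) g
  ∑-over-neighbours v g = trans (∑-cong R (λ y → cong (if_then g y else 0) (cayleyAdj≡∈ᵇ v y)))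
                                (∑-range-∈ᵇ n (neighbours-unique v) (neighbours-bounded v) g)

  cayleyAdj-irrefl : ∀ {x} → x < n → C x x ≡ false
  cayleyAdj-irrefl {x} x<n = any-false-on D-bounds λ {d} (0<d , d<n) → ≡ᵇ-false λ eq →
    <⇒≱ 0<d (subst (_≤ 0) (trans (sym (d%n≡0%n d eq)) (m<n⇒m%n≡m d<n)) (m%n≤m 0 n))
    where
    d%n≡0%n : ∀ d → (x + d) % n ≡ x → d % n ≡ 0 % n
    d%n≡0%n d eq = [m+o]%n≡[m+p]%n⇒o%n≡p%n x d 0 (trans eq (sym (trans (cong (_% n) (+-identityʳ x)) (m<n⇒m%n≡m x<n))))

  cayleyAdj-translate : ∀ v d₁ {d₂} → d₂ < n → C ((v + d₁) % n) ((v + d₂) % n) ≡ C d₁ d₂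
  cayleyAdj-translate v d₁ {d₂} d₂<n = any-cong D (λ d → ≡ᵇ-cong-⇔ (to d) (from d))
    where
    shift : ∀ d → ((v + d₁) % n + d) % n ≡ (v + (d₁ + d)) % n
    shift d = trans ([m%n+o]%n≡[m+o]%n (v + d₁) d) (cong (_% n) (+-assoc v d₁ d))
    to : ∀ d → ((v + d₁) % n + d) % n ≡ (v + d₂) % n → (d₁ + d) % n ≡ d₂
    to d eq = trans ([m+o]%n≡[m+p]%n⇒o%n≡p%n v _ _ (trans (sym (shift d)) eq)) (m<n⇒m%n≡m d₂<n)
    from : ∀ d → (d₁ + d) % n ≡ d₂ → ((v + d₁) % n + d) % n ≡ (v + d₂) % n
    from d eq = begin
      ((v + d₁) % n + d) % n  ≡⟨ shift d ⟩
      (v + (d₁ + d)) % n      ≡⟨ cong (_% n) (+-comm v (d₁ + d)) ⟩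
      ((d₁ + d) + v) % n      ≡⟨ sym ([m%n+o]%n≡[m+o]%n (d₁ + d) v) ⟩
      ((d₁ + d) % n + v) % n  ≡⟨ cong (λ z → (z + v) % n) eq ⟩
      (d₂ + v) % n            ≡⟨ cong (_% n) (+-comm d₂ v) ⟩
      (v + d₂) % n            ∎
      where open ≡-Reasoning

  degree : ∀ (v : Fin n) → circDeg n S v ≡ length D
  degree v = begin
    circDeg n S v
      ≡⟨ sum-allFin n _ ⟩
    ∑[ y ∈ R ] ⟦ circAdjℕ n S (toℕ v) y ⟧
      ≡⟨ ∑-cong-on R-bounds (λ (_ , y<n) → cong ⟦_⟧ (adj≡ (toℕ<n v) y<n)) ⟩
    ∑[ y ∈ R ] (if C (toℕ v) y then 1 else 0)
      ≡⟨ ∑-over-neighbours (toℕ v) (λ _ → 1) ⟩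
    ∑[ _ ∈ neighbours (toℕ v) ] 1
      ≡⟨ trans (∑-const (neighbours (toℕ v)) 1) (*-identityʳ _) ⟩
    length (neighbours (toℕ v))
      ≡⟨ length-map _ D ⟩
    length D ∎
    where open ≡-Reasoning

  edges : ∀ (v : Fin n) → circE n S v * 2 ≡ linkedPairs n D
  edges v = begin
    circE n S v * 2
      ≡⟨ cong (_* 2) (trans (sum-allFin n _) (∑-cong R (λ x → sum-allFin n _))) ⟩
    (∑[ x ∈ R ] ∑[ y ∈ R ] ⟦ (x <ᵇ y) ∧ h x y ⟧) * 2
      ≡⟨ ∑∑-symmetrize h h-sym h-irrefl R-bounds ⟩
    ∑[ x ∈ R ] ∑[ y ∈ R ] ⟦ h x y ⟧
      ≡⟨ ∑-cong-on R-bounds (λ (_ , x<n) → ∑-cong-on R-bounds (λ (_ , y<n) → cong ⟦_⟧ (h≡ x<n y<n))) ⟩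
    ∑[ x ∈ R ] ∑[ y ∈ R ] ⟦ C v′ x ∧ (C v′ y ∧ C x y) ⟧
      ≡⟨ ∑-cong R (λ x → trans (∑-cong R (λ y → ⟦∧⟧ (C v′ x) _)) (∑-if R (C v′ x) _)) ⟩
    ∑[ x ∈ R ] (if C v′ x then ∑[ y ∈ R ] ⟦ C v′ y ∧ C x y ⟧ else 0)
      ≡⟨ ∑-over-neighbours v′ _ ⟩
    ∑[ x ∈ N ] ∑[ y ∈ R ] ⟦ C v′ y ∧ C x y ⟧
      ≡⟨ ∑-cong N (λ x → trans (∑-cong R (λ y → ⟦∧⟧ (C v′ y) _)) (∑-over-neighbours v′ _)) ⟩
    ∑[ x ∈ N ] ∑[ y ∈ N ] ⟦ C x y ⟧
      ≡⟨ trans (∑-map _ D _) (∑-cong D (λ d₁ → ∑-map _ D _)) ⟩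
    ∑[ d₁ ∈ D ] ∑[ d₂ ∈ D ] ⟦ C ((v′ + d₁) % n) ((v′ + d₂) % n) ⟧
      ≡⟨ ∑-cong D (λ d₁ → ∑-cong-on D-bounds (λ (_ , d₂<n) → cong ⟦_⟧ (cayleyAdj-translate v′ d₁ d₂<n))) ⟩
    linkedPairs n D ∎
    where
    open ≡-Reasoning
    v′ : ℕ
    v′ = toℕ v
    N : List ℕ
    N = neighbours v′
    A : ℕ → ℕ → Bool
    A = circAdjℕ n S
    h : ℕ → ℕ → Bool
    h x y = A v′ x ∧ A v′ y ∧ A x y
    h-sym : ∀ {x y} → 0 ≤ x × x < n → 0 ≤ y × y < n → h x y ≡ h y x
    h-sym {x} {y} _ _ = begin
      A v′ x ∧ (A v′ y ∧ A x y)   ≡⟨ sym (∧-assoc (A v′ x) _ _) ⟩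
      (A v′ x ∧ A v′ y) ∧ A x y   ≡⟨ cong₂ _∧_ (∧-comm (A v′ x) _) (circAdjℕ-sym S x y) ⟩
      (A v′ y ∧ A v′ x) ∧ A y x   ≡⟨ ∧-assoc (A v′ y) _ _ ⟩
      A v′ y ∧ (A v′ x ∧ A y x)   ∎
    h-irrefl : ∀ {x} → 0 ≤ x × x < n → h x x ≡ false
    h-irrefl {x} (_ , x<n) rewrite adj≡ x<n x<n | cayleyAdj-irrefl x<n | ∧-zeroʳ (A v′ x) = ∧-zeroʳ (A v′ x)
    h≡ : ∀ {x y} → x < n → y < n → h x y ≡ C v′ x ∧ (C v′ y ∧ C x y)
    h≡ x<n y<n = cong₂ _∧_ (adj≡ (toℕ<n v) x<n) (cong₂ _∧_ (adj≡ (toℕ<n v) y<n) (adj≡ x<n y<n))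

  isRCCirc : ∀ {r c} → length D ≡ r → linkedPairs n D ≡ c * 2 → IsRCCirc n S r c
  isRCCirc refl linked v = degree v , *-cancelʳ-≡ _ _ 2 (trans (edges v) linked)

-- Linked pairs

linkedPairs-scale : ∀ K k .{{_ : NonZero K}} .{{_ : NonZero k}} D →
                    linkedPairs (K * k) {{m*n≢0 K k}} (map (_* k) D) ≡ linkedPairs K D
linkedPairs-scale K k D = begin
  ∑[ x ∈ map (_* k) D ] ∑[ y ∈ map (_* k) D ] ⟦ C′ x y ⟧
    ≡⟨ trans (∑-map _ D _) (∑-cong D (λ u₁ → ∑-map _ D _)) ⟩
  ∑[ u₁ ∈ D ] ∑[ u₂ ∈ D ] ⟦ C′ (u₁ * k) (u₂ * k) ⟧
    ≡⟨ ∑-cong D (λ u₁ → ∑-cong D (λ u₂ → cong ⟦_⟧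
         (trans (any-map _ (_* k) D) (any-cong D (λ w → scaled u₁ w u₂))))) ⟩
  linkedPairs K D ∎
  where
  open ≡-Reasoning
  instance
    Kk≢0 : NonZero (K * k)
    Kk≢0 = m*n≢0 K k
  C′ : ℕ → ℕ → Bool
  C′ = cayleyAdj (K * k) (map (_* k) D)
  scaled : ∀ u₁ w u₂ → ((u₁ * k + w * k) % (K * k) ≡ᵇ u₂ * k) ≡ ((u₁ + w) % K ≡ᵇ u₂)
  scaled u₁ w u₂ = ≡ᵇ-cong-⇔ {_} {u₂ * k} {(u₁ + w) % K} {u₂}
    (λ eq → *-cancelʳ-≡ _ _ k (trans (sym factor) eq)) (λ eq → trans factor (cong (_* k) eq))
    where
    factor : (u₁ * k + w * k) % (K * k) ≡ (u₁ + w) % K * k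
    factor = trans (cong (_% (K * k)) (sym (*-distribʳ-+ k u₁ w))) (sym (m%n*o≡m*o%[n*o] (u₁ + w) K k))

module _ {n : ℕ} .{{_ : NonZero n}} {Inside Far : ℕ → Set}
  (unlinked : ∀ {x d y} → Inside x → Inside d → Inside y → Far x ⊎ Far d ⊎ Far y → (x + d) % n ≢ y) where

  linkedPairs-++-unlinked : ∀ {D F} → All Inside D → All (λ x → Inside x × Far x) F →
                            linkedPairs n (D ++ F) ≡ linkedPairs n D
  linkedPairs-++-unlinked {D} {F} inD farF = begin
    ∑[ x ∈ D ++ F ] ∑[ y ∈ D ++ F ] ⟦ C′ x y ⟧
      ≡⟨ ∑-++ D F _ ⟩
    ∑[ x ∈ D ] ∑[ y ∈ D ++ F ] ⟦ C′ x y ⟧ + ∑[ x ∈ F ] ∑[ y ∈ D ++ F ] ⟦ C′ x y ⟧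
      ≡⟨ cong₂ _+_ (∑-cong-on inD (λ ix → ∑-++ D F _))
                   (∑-≡0-on farF (λ (ix , fx) → ∑-≡0-on inDF (λ iy → cong ⟦_⟧ (no-link ix iy (inj₁ fx))))) ⟩
    ∑[ x ∈ D ] (∑[ y ∈ D ] ⟦ C′ x y ⟧ + ∑[ y ∈ F ] ⟦ C′ x y ⟧) + 0
      ≡⟨ trans (+-identityʳ _) (∑-cong-on inD (λ ix → cong₂ _+_
           (∑-cong-on inD (λ iy → cong ⟦_⟧ (restrict ix iy)))
           (∑-≡0-on farF (λ (iy , fy) → cong ⟦_⟧ (no-link ix iy (inj₂ (inj₂ fy))))))) ⟩
    ∑[ x ∈ D ] (∑[ y ∈ D ] ⟦ cayleyAdj n D x y ⟧ + 0)
      ≡⟨ ∑-cong D (λ x → +-identityʳ _) ⟩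
    linkedPairs n D ∎
    where
    open ≡-Reasoning
    C′ : ℕ → ℕ → Bool
    C′ = cayleyAdj n (D ++ F)
    inDF : All Inside (D ++ F)
    inDF = All.++⁺ inD (All.map proj₁ farF)
    no-link : ∀ {x y} → Inside x → Inside y → (∀ {d} → Far x ⊎ Far d ⊎ Far y) → C′ x y ≡ false
    no-link ix iy far = any-false-on inDF (λ id → ≡ᵇ-false (unlinked ix id iy far))
    restrict : ∀ {x y} → Inside x → Inside y → C′ x y ≡ cayleyAdj n D x y
    restrict ix iy = trans (any-++ _ D F) (trans (cong (_ ∨_)
      (any-false-on farF (λ (id , fd) → ≡ᵇ-false (unlinked ix id iy (inj₂ (inj₁ fd)))))) (∨-identityʳ _))

schurPairs : List ℕ → ℕ
schurPairs P = ∑[ a ∈ P ] ∑[ b ∈ P ] ⟦ (a + b) ∈ᵇ P ⟧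

module _ {K m : ℕ} .{{_ : NonZero K}} {P : List ℕ} (P-unique : Unique P)
  (P-bounds : All (λ a → 0 < a × a ≤ m) P) (3m<K : 3 * m < K) where

  private
    Small : ℕ → Set
    Small a = 0 < a × a ≤ m

    2m≤3m : m + m ≤ 3 * m
    2m≤3m = +-monoʳ-≤ m (m≤m+n m (m + 0))

    small<K : ∀ {a} → Small a → a < K
    small<K (_ , a≤m) = ≤-<-trans (≤-trans a≤m (m≤m+n m _)) 3m<K

    pair<K : ∀ {a c} → Small a → Small c → a + c < K
    pair<K (_ , a≤m) (_ , c≤m) = ≤-<-trans (≤-trans (+-mono-≤ a≤m c≤m) 2m≤3m) 3m<K

    neg<K : ∀ {a} → Small a → K ∸ a < K
    neg<K sa@(0<a , _) = ∸-monoʳ-< 0<a (<⇒≤ (small<K sa))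

    Step : ℕ → ℕ → Bool
    Step x y = any (λ c → (x + c) % K ≡ᵇ y) P

    Diff : ℕ → ℕ → Bool
    Diff a b = any (λ c → a + c ≡ᵇ b) P

    adj-as-steps : ∀ {x y} → x < K → y < K → cayleyAdj K (P ++ map (K ∸_) P) x y ≡ Step x y ∨ Step y x
    adj-as-steps {x} {y} x<K y<K = trans (any-++ _ P _) (cong (Step x y ∨_) (trans (any-map _ (K ∸_) P)
      (any-cong-on P-bounds (λ sc → ≡ᵇ-%-negate x<K y<K (<⇒≤ (small<K sc))))))

    step-++ : ∀ {a b} → Small a → Small b → Step a b ≡ Diff a b
    step-++ {a} {b} sa sb = any-cong-on P-bounds (λ sc → cong (_≡ᵇ b) (m<n⇒m%n≡m (pair<K sa sc)))

    step-+- : ∀ {a b} → Small a → Small b → Step a (K ∸ b) ≡ false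
    step-+- {a} {b} sa@(_ , a≤m) sb@(_ , b≤m) = any-false-on P-bounds λ {c} sc@(_ , c≤m) → ≡ᵇ-false λ eq →
      <⇒≢ (≤-<-trans (+-mono-≤ (+-mono-≤ a≤m c≤m) b≤m) (subst (_< K) (3m≡m+m+m m) 3m<K))
        (trans (cong (_+ b) (trans (sym (m<n⇒m%n≡m (pair<K sa sc))) eq)) (m∸n+n≡m (<⇒≤ (small<K sb))))
      where
      3m≡m+m+m : ∀ m → 3 * m ≡ m + m + m
      3m≡m+m+m = solve-∀

    step--+ : ∀ {a b} → Small a → Small b → Step (K ∸ a) b ≡ (a + b) ∈ᵇ P
    step--+ {a} {b} sa sb = any-cong-on P-bounds λ {c} sc → begin
      ((K ∸ a) + c) % K ≡ᵇ b   ≡⟨ cong (λ z → z % K ≡ᵇ b) (+-comm (K ∸ a) c) ⟩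
      (c + (K ∸ a)) % K ≡ᵇ b   ≡⟨ ≡ᵇ-%-negate (small<K sc) (small<K sb) (<⇒≤ (small<K sa)) ⟩
      (b + a) % K ≡ᵇ c         ≡⟨ cong (_≡ᵇ c) (trans (m<n⇒m%n≡m (pair<K sb sa)) (+-comm b a)) ⟩
      a + b ≡ᵇ c               ≡⟨ ≡ᵇ-sym (a + b) c ⟩
      c ≡ᵇ a + b               ∎
      where open ≡-Reasoning

    step--- : ∀ {a b} → Small a → Small b → Step (K ∸ a) (K ∸ b) ≡ Diff b a
    step--- {a} {b} sa sb = any-cong-on P-bounds λ {c} sc → begin
      ((K ∸ a) + c) % K ≡ᵇ (K ∸ b)   ≡⟨ cong (λ z → z % K ≡ᵇ (K ∸ b)) (+-comm (K ∸ a) c) ⟩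
      (c + (K ∸ a)) % K ≡ᵇ (K ∸ b)   ≡⟨ ≡ᵇ-%-negate (small<K sc) (neg<K sb) (<⇒≤ (small<K sa)) ⟩
      ((K ∸ b) + a) % K ≡ᵇ c         ≡⟨ cong (λ z → z % K ≡ᵇ c) (+-comm (K ∸ b) a) ⟩
      (a + (K ∸ b)) % K ≡ᵇ c         ≡⟨ ≡ᵇ-%-negate (small<K sa) (small<K sc) (<⇒≤ (small<K sb)) ⟩
      (c + b) % K ≡ᵇ a               ≡⟨ cong (_≡ᵇ a) (trans (m<n⇒m%n≡m (pair<K sc sb)) (+-comm c b)) ⟩
      b + c ≡ᵇ a                     ∎
      where open ≡-Reasoning

    diff-false : ∀ {a b} → b ≤ a → Diff a b ≡ false
    diff-false {a} b≤a = any-false-on P-bounds λ (0<c , _) → ≡ᵇ-false λ a+c≡b →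
      <⇒≱ (subst (a <_) a+c≡b (m<m+n a 0<c)) b≤a

    diff-asym : ∀ a b → Diff a b ≡ true → Diff b a ≡ false
    diff-asym a b ab with ≤-total a b
    ... | inj₁ a≤b = diff-false a≤b
    ... | inj₂ b≤a = contradiction (trans (sym ab) (diff-false b≤a)) λ ()

    C : ℕ → ℕ → Bool
    C = cayleyAdj K (P ++ map (K ∸_) P)

    adj-++ : ∀ {a b} → Small a → Small b → C a b ≡ Diff a b ∨ Diff b a
    adj-++ sa sb = trans (adj-as-steps (small<K sa) (small<K sb)) (cong₂ _∨_ (step-++ sa sb) (step-++ sb sa))

    adj-+- : ∀ {a b} → Small a → Small b → C a (K ∸ b) ≡ (a + b) ∈ᵇ P
    adj-+- {a} {b} sa sb = trans (adj-as-steps (small<K sa) (neg<K sb))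
      (trans (cong₂ _∨_ (step-+- sa sb) (step--+ sb sa)) (cong (_∈ᵇ P) (+-comm b a)))

    adj--+ : ∀ {a b} → Small a → Small b → C (K ∸ a) b ≡ (a + b) ∈ᵇ P
    adj--+ sa sb = trans (adj-as-steps (neg<K sa) (small<K sb))
      (trans (cong₂ _∨_ (step--+ sa sb) (step-+- sb sa)) (∨-identityʳ _))

    adj--- : ∀ {a b} → Small a → Small b → C (K ∸ a) (K ∸ b) ≡ Diff a b ∨ Diff b a
    adj--- {a} {b} sa sb = trans (adj-as-steps (neg<K sa) (neg<K sb))
      (trans (cong₂ _∨_ (step--- sa sb) (step--- sb sa)) (∨-comm (Diff b a) (Diff a b)))

    Y : ℕ
    Y = schurPairs P

    ∑∑diff≡schurPairs : ∑[ a ∈ P ] ∑[ b ∈ P ] ⟦ Diff a b ⟧ ≡ Y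
    ∑∑diff≡schurPairs = begin
      ∑[ a ∈ P ] ∑[ b ∈ P ] ⟦ Diff a b ⟧
        ≡⟨ ∑-cong P (λ a → ∑-cong P (λ b → ⟦any⟧≡∑ P-unique (λ {c} {c′} p q →
             +-cancelˡ-≡ a c c′ (trans (≡ᵇ⇒≡ (a + c) b p) (sym (≡ᵇ⇒≡ (a + c′) b q)))))) ⟩
      ∑[ a ∈ P ] ∑[ b ∈ P ] ∑[ c ∈ P ] ⟦ a + c ≡ᵇ b ⟧
        ≡⟨ ∑-cong P (λ a → ∑-comm P P _) ⟩
      ∑[ a ∈ P ] ∑[ c ∈ P ] ∑[ b ∈ P ] ⟦ a + c ≡ᵇ b ⟧
        ≡⟨ ∑-cong P (λ a → ∑-cong P (λ c →
             trans (∑-cong P (λ b → cong ⟦_⟧ (≡ᵇ-sym (a + c) b))) (sym (⟦∈ᵇ⟧≡∑ P-unique)))) ⟩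
      Y ∎
      where open ≡-Reasoning

    Pairs Sums : ℕ → ℕ
    Pairs a = ∑[ b ∈ P ] ⟦ Diff a b ∨ Diff b a ⟧
    Sums a = ∑[ b ∈ P ] ⟦ (a + b) ∈ᵇ P ⟧

    ∑-pairs : ∑ P Pairs ≡ Y + Y
    ∑-pairs = begin
      ∑[ a ∈ P ] ∑[ b ∈ P ] ⟦ Diff a b ∨ Diff b a ⟧
        ≡⟨ ∑-cong P (λ a → ∑-cong P (λ b → if-∨ (Diff a b) (Diff b a) 1 (diff-asym a b))) ⟩
      ∑[ a ∈ P ] ∑[ b ∈ P ] (⟦ Diff a b ⟧ + ⟦ Diff b a ⟧)
        ≡⟨ trans (∑-cong P (λ a → ∑-distrib-+ P _ _)) (∑-distrib-+ P _ _) ⟩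
      ∑[ a ∈ P ] ∑[ b ∈ P ] ⟦ Diff a b ⟧ + ∑[ a ∈ P ] ∑[ b ∈ P ] ⟦ Diff b a ⟧
        ≡⟨ cong (∑[ a ∈ P ] ∑[ b ∈ P ] ⟦ Diff a b ⟧ +_) (∑-comm P P (λ a b → ⟦ Diff b a ⟧)) ⟩
      ∑[ a ∈ P ] ∑[ b ∈ P ] ⟦ Diff a b ⟧ + ∑[ b ∈ P ] ∑[ a ∈ P ] ⟦ Diff b a ⟧
        ≡⟨ cong₂ _+_ ∑∑diff≡schurPairs ∑∑diff≡schurPairs ⟩
      Y + Y ∎
      where open ≡-Reasoning

    ∑-± : ∀ (g : ℕ → ℕ) → ∑ (P ++ map (K ∸_) P) g ≡ ∑ P g + ∑[ a ∈ P ] g (K ∸ a)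
    ∑-± g = trans (∑-++ P _ g) (cong (∑ P g +_) (∑-map (K ∸_) P g))

  linkedPairs-± : linkedPairs K (P ++ map (K ∸_) P) ≡ 6 * schurPairs P
  linkedPairs-± = begin
    linkedPairs K (P ++ map (K ∸_) P)
      ≡⟨ trans (∑-± _) (cong₂ _+_ (∑-cong P (λ a → ∑-± _)) (∑-cong P (λ a → ∑-± _))) ⟩
    ∑[ a ∈ P ] (∑[ b ∈ P ] ⟦ C a b ⟧ + ∑[ b ∈ P ] ⟦ C a (K ∸ b) ⟧)
      + ∑[ a ∈ P ] (∑[ b ∈ P ] ⟦ C (K ∸ a) b ⟧ + ∑[ b ∈ P ] ⟦ C (K ∸ a) (K ∸ b) ⟧)
      ≡⟨ cong₂ _+_
           (∑-cong-on P-bounds (λ sa → cong₂ _+_ (∑-cong-on P-bounds (λ sb → cong ⟦_⟧ (adj-++ sa sb)))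
                                                 (∑-cong-on P-bounds (λ sb → cong ⟦_⟧ (adj-+- sa sb)))))
           (∑-cong-on P-bounds (λ sa → cong₂ _+_ (∑-cong-on P-bounds (λ sb → cong ⟦_⟧ (adj--+ sa sb)))
                                                 (∑-cong-on P-bounds (λ sb → cong ⟦_⟧ (adj--- sa sb))))) ⟩
    ∑[ a ∈ P ] (Pairs a + Sums a) + ∑[ a ∈ P ] (Sums a + Pairs a)
      ≡⟨ cong₂ _+_ (∑-distrib-+ P Pairs Sums) (∑-distrib-+ P Sums Pairs) ⟩
    (∑ P Pairs + Y) + (Y + ∑ P Pairs)
      ≡⟨ cong (λ z → (z + Y) + (Y + z)) ∑-pairs ⟩
    (Y + Y + Y) + (Y + (Y + Y))
      ≡⟨ six Y ⟩
    6 * Y ∎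
    where
    open ≡-Reasoning
    six : ∀ y → (y + y + y) + (y + (y + y)) ≡ 6 * y
    six = solve-∀

-- Schur pairs of {1,…,k} ∪ {2k + 1 − j}

[1+l]C2 : ∀ l → suc l C 2 ≡ l + l C 2
[1+l]C2 l = trans (sym (nCk+nC[k+1]≡[n+1]C[k+1] l 1)) (cong (_+ l C 2) (nC1≡n l))

2*[lC2] : ∀ l → 2 * (l C 2) ≡ l * (l ∸ 1)
2*[lC2] zero    = refl
2*[lC2] (suc l) = begin
  2 * (suc l C 2)        ≡⟨ cong (2 *_) ([1+l]C2 l) ⟩
  2 * (l + l C 2)        ≡⟨ *-distribˡ-+ 2 l (l C 2) ⟩
  2 * l + 2 * (l C 2)    ≡⟨ cong (2 * l +_) (2*[lC2] l) ⟩
  2 * l + l * (l ∸ 1)    ≡⟨ lemma l ⟩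
  suc l * l              ∎
  where
  open ≡-Reasoning
  lemma : ∀ l → 2 * l + l * (l ∸ 1) ≡ suc l * l
  lemma zero    = refl
  lemma (suc l) = expand l
    where
    expand : ∀ l → 2 * suc l + suc l * l ≡ suc (suc l) * suc l
    expand = solve-∀

∑-range-∸≡C2 : ∀ s l → ∑[ a ∈ range s l ] (s + l ∸ suc a) ≡ l C 2
∑-range-∸≡C2 s zero    = refl
∑-range-∸≡C2 s (suc l) = begin
  (s + suc l ∸ suc s) + ∑[ a ∈ range (suc s) l ] (s + suc l ∸ suc a)
    ≡⟨ cong₂ _+_ (trans (cong (_∸ suc s) (+-suc s l)) (m+n∸m≡n s l))
                 (cong (λ z → ∑[ a ∈ range (suc s) l ] (z ∸ suc a)) (+-suc s l)) ⟩
  l + ∑[ a ∈ range (suc s) l ] (suc s + l ∸ suc a)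
    ≡⟨ cong (l +_) (∑-range-∸≡C2 (suc s) l) ⟩
  l + l C 2
    ≡⟨ sym ([1+l]C2 l) ⟩
  suc l C 2 ∎
  where open ≡-Reasoning

module SegmentAndPoint (p j : ℕ) where

  k m : ℕ
  k = p + j
  m = suc (k + p)

  P : List ℕ
  P = range 1 k ++ m ∷ []

  private
    R : List ℕ
    R = range 1 k

    R-bounds : All (λ a → 1 ≤ a × a < 1 + k) R
    R-bounds = range-bounds 1 k

    k<m : k < m
    k<m = s≤s (m≤m+n k p)

  P-bounds : All (λ a → 0 < a × a ≤ m) P
  P-bounds = All.++⁺ (All.map (λ (1≤a , a≤k) → 1≤a , <⇒≤ (<-≤-trans a≤k k<m)) R-bounds) ((z<s , ≤-refl) ∷ [])

  P-unique : Unique P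
  P-unique = Unique.++⁺ (range-unique 1 k) ([] ∷ [])
    (disjoint-by R-bounds (refl ∷ []) (λ (_ , a<1+k) a≡m → <⇒≢ (<-≤-trans a<1+k k<m) a≡m))

  private
    ∈ᵇP-split : ∀ z → ⟦ z ∈ᵇ P ⟧ ≡ ⟦ z ∈ᵇ R ⟧ + ⟦ m ≡ᵇ z ⟧
    ∈ᵇP-split z = begin
      ⟦ z ∈ᵇ P ⟧                                  ≡⟨ ⟦∈ᵇ⟧≡∑ P-unique ⟩
      ∑[ c ∈ P ] ⟦ c ≡ᵇ z ⟧                       ≡⟨ ∑-++ R _ _ ⟩
      ∑[ c ∈ R ] ⟦ c ≡ᵇ z ⟧ + (⟦ m ≡ᵇ z ⟧ + 0)
        ≡⟨ cong₂ _+_ (sym (⟦∈ᵇ⟧≡∑ (range-unique 1 k))) (+-identityʳ _) ⟩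
      ⟦ z ∈ᵇ R ⟧ + ⟦ m ≡ᵇ z ⟧                     ∎
      where open ≡-Reasoning

    ∈ᵇP-above : ∀ {z} → m < z → z ∈ᵇ P ≡ false
    ∈ᵇP-above m<z = any-false-on P-bounds λ (_ , c≤m) → ≡ᵇ-false λ c≡z → <⇒≱ m<z (subst (_≤ m) c≡z c≤m)

    ∑-shift : ∀ a (g : ℕ → ℕ) → ∑[ b ∈ R ] g (a + b) ≡ ∑ (range (a + 1) k) g
    ∑-shift a g = trans (sym (∑-map (a +_) R g)) (cong (λ xs → ∑ xs g) (map-+-range a 1 k))

    a+1+k≡1+k+a : ∀ a k → a + 1 + k ≡ suc (k + a)
    a+1+k≡1+k+a = solve-∀

    without-m : ∑[ a ∈ P ] ∑[ b ∈ P ] ⟦ (a + b) ∈ᵇ P ⟧ ≡ ∑[ a ∈ R ] ∑[ b ∈ R ] ⟦ (a + b) ∈ᵇ P ⟧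
    without-m = begin
      ∑[ a ∈ P ] ∑[ b ∈ P ] ⟦ (a + b) ∈ᵇ P ⟧
        ≡⟨ ∑-++ R _ _ ⟩
      ∑[ a ∈ R ] ∑[ b ∈ P ] ⟦ (a + b) ∈ᵇ P ⟧ + (∑[ b ∈ P ] ⟦ (m + b) ∈ᵇ P ⟧ + 0)
        ≡⟨ cong₂ _+_ (∑-cong-on R-bounds (λ {a} (1≤a , _) → trans (∑-++ R _ _)
                        (cong (∑[ b ∈ R ] ⟦ (a + b) ∈ᵇ P ⟧ +_) (cong (_+ 0) (cong ⟦_⟧ (∈ᵇP-above (m<n+m m 1≤a)))))))
                     (trans (+-identityʳ _) (∑-≡0-on P-bounds (λ (0<b , _) → cong ⟦_⟧ (∈ᵇP-above (m<m+n m 0<b))))) ⟩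
      ∑[ a ∈ R ] (∑[ b ∈ R ] ⟦ (a + b) ∈ᵇ P ⟧ + 0) + 0
        ≡⟨ trans (+-identityʳ _) (∑-cong R (λ a → +-identityʳ _)) ⟩
      ∑[ a ∈ R ] ∑[ b ∈ R ] ⟦ (a + b) ∈ᵇ P ⟧ ∎
      where open ≡-Reasoning

    sums-in-R : ∀ {a} → a ≤ k → ∑[ b ∈ R ] ⟦ (a + b) ∈ᵇ R ⟧ ≡ k ∸ a
    sums-in-R {a} a≤k = begin
      ∑[ b ∈ R ] ⟦ (a + b) ∈ᵇ R ⟧
        ≡⟨ ∑-shift a _ ⟩
      ∑[ z ∈ range (a + 1) k ] ⟦ z ∈ᵇ R ⟧
        ≡⟨ cong (λ l → ∑[ z ∈ range (a + 1) l ] ⟦ z ∈ᵇ R ⟧) (sym (m∸n+n≡m a≤k)) ⟩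
      ∑[ z ∈ range (a + 1) ((k ∸ a) + a) ] ⟦ z ∈ᵇ R ⟧
        ≡⟨ trans (cong (λ xs → ∑[ z ∈ xs ] ⟦ z ∈ᵇ R ⟧) (range-++ (a + 1) (k ∸ a) a))
                 (∑-++ (range (a + 1) (k ∸ a)) (range (a + 1 + (k ∸ a)) a) _) ⟩
      ∑[ z ∈ range (a + 1) (k ∸ a) ] ⟦ z ∈ᵇ R ⟧ + ∑[ z ∈ range (a + 1 + (k ∸ a)) a ] ⟦ z ∈ᵇ R ⟧
        ≡⟨ cong₂ _+_
             (∑-cong-on (range-bounds (a + 1) (k ∸ a)) (λ {z} (a+1≤z , z<) →
                ⟦∈ᵇrange⟧ 1 k (≤-trans (m≤n+m 1 a) a+1≤z) (subst (z <_) end≡ z<)))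
             (∑-≡0-on (range-bounds (a + 1 + (k ∸ a)) a) (λ {z} (end≤z , _) →
                cong ⟦_⟧ (∈ᵇrange-out 1 k (subst (_≤ z) end≡ end≤z)))) ⟩
      ∑[ _ ∈ range (a + 1) (k ∸ a) ] 1 + 0
        ≡⟨ trans (+-identityʳ _) (trans (∑-const (range (a + 1) (k ∸ a)) 1)
                 (trans (*-identityʳ _) (length-range (a + 1) (k ∸ a)))) ⟩
      k ∸ a ∎
      where
      open ≡-Reasoning
      end≡ : a + 1 + (k ∸ a) ≡ 1 + k
      end≡ = trans (cong (_+ (k ∸ a)) (+-comm a 1)) (cong suc (m+[n∸m]≡n a≤k))

    sums-to-m : ∀ a → ∑[ b ∈ R ] ⟦ m ≡ᵇ a + b ⟧ ≡ ∑[ z ∈ range (a + 1) k ] ⟦ m ≡ᵇ z ⟧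
    sums-to-m a = ∑-shift a (λ z → ⟦ m ≡ᵇ z ⟧)

    pairs-to-m : ∑[ a ∈ R ] ∑[ b ∈ R ] ⟦ m ≡ᵇ a + b ⟧ ≡ j
    pairs-to-m = begin
      ∑[ a ∈ R ] ∑[ b ∈ R ] ⟦ m ≡ᵇ a + b ⟧
        ≡⟨ trans (cong (λ xs → ∑[ a ∈ xs ] ∑[ b ∈ R ] ⟦ m ≡ᵇ a + b ⟧) (range-++ 1 p j))
                 (∑-++ (range 1 p) (range (1 + p) j) _) ⟩
      ∑[ a ∈ range 1 p ] ∑[ b ∈ R ] ⟦ m ≡ᵇ a + b ⟧ + ∑[ a ∈ range (1 + p) j ] ∑[ b ∈ R ] ⟦ m ≡ᵇ a + b ⟧
        ≡⟨ cong₂ _+_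
             (∑-≡0-on (range-bounds 1 p) (λ {a} (_ , a<1+p) → trans (sums-to-m a)
                (∑-range-≡ᵇ-out m (a + 1) k (λ _ → 1) (inj₂ (subst (_≤ m) (sym (a+1+k≡1+k+a a k))
                  (s≤s (+-monoʳ-≤ k (≤-pred a<1+p))))))))
             (∑-cong-on (range-bounds (1 + p) j) (λ {a} (1+p≤a , a<) → trans (sums-to-m a)
                (∑-range-≡ᵇ m (a + 1) k (λ _ → 1)
                  (subst (_≤ m) (+-comm 1 a) (s≤s (≤-trans (≤-pred a<) (m≤m+n k p))))
                  (subst (m <_) (sym (a+1+k≡1+k+a a k)) (s≤s (+-monoʳ-< k 1+p≤a)))))) ⟩
      0 + ∑[ _ ∈ range (1 + p) j ] 1
        ≡⟨ trans (∑-const (range (1 + p) j) 1) (trans (*-identityʳ _) (length-range (1 + p) j)) ⟩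
      j ∎
      where open ≡-Reasoning

  schurPairs-P : schurPairs P ≡ k C 2 + j
  schurPairs-P = begin
    ∑[ a ∈ P ] ∑[ b ∈ P ] ⟦ (a + b) ∈ᵇ P ⟧
      ≡⟨ without-m ⟩
    ∑[ a ∈ R ] ∑[ b ∈ R ] ⟦ (a + b) ∈ᵇ P ⟧
      ≡⟨ ∑-cong R (λ a → trans (∑-cong R (λ b → ∈ᵇP-split (a + b))) (∑-distrib-+ R _ _)) ⟩
    ∑[ a ∈ R ] (∑[ b ∈ R ] ⟦ (a + b) ∈ᵇ R ⟧ + ∑[ b ∈ R ] ⟦ m ≡ᵇ a + b ⟧)
      ≡⟨ ∑-distrib-+ R _ _ ⟩
    ∑[ a ∈ R ] ∑[ b ∈ R ] ⟦ (a + b) ∈ᵇ R ⟧ + ∑[ a ∈ R ] ∑[ b ∈ R ] ⟦ m ≡ᵇ a + b ⟧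
      ≡⟨ cong₂ _+_ (trans (∑-cong-on R-bounds (λ (_ , a<1+k) → sums-in-R (≤-pred a<1+k))) (∑-range-∸≡C2 1 k))
                   pairs-to-m ⟩
    k C 2 + j ∎
    where open ≡-Reasoning

-- The construction

optional : Bool → ℕ → List ℕ
optional true  x = x ∷ []
optional false x = []

length-optional : ∀ b x → length (optional b x) ≡ ⟦ b ⟧
length-optional true  x = refl
length-optional false x = refl

map-optional : ∀ (f : ℕ → ℕ) b x → map f (optional b x) ≡ optional b (f x)
map-optional f true  x = refl
map-optional f false x = refl

optional-unique : ∀ b x → Unique (optional b x)
optional-unique true  x = [] ∷ []
optional-unique false x = []

All-optional : ∀ {P : ℕ → Set} b {x} → P x → All P (optional b x)
All-optional true  px = px ∷ []
All-optional false px = []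

module Construction (p j t : ℕ) (b : Bool) where

  open SegmentAndPoint p j

  K g n N : ℕ
  K = 2 + 4 * m
  g = suc (2 * t)
  n = K * g
  N = suc (2 * m) * g

  -- The lower end 2 m g + suc t of Far is N ∸ t, written without truncated subtraction.
  Low High Far Class : ℕ → Set
  Low  x = x ∈[ 1 * g , m * g ]
  High x = x ∈[ (2 + 3 * m) * g , (1 + 4 * m) * g ]
  Far  x = x ∈[ 2 * m * g + suc t , N + t ]
  Class x = Low x ⊎ High x ⊎ Far x

  private
    n≡N+N : n ≡ N + N
    n≡N+N = e m t
      where
      e : ∀ m t → (2 + 4 * m) * suc (2 * t) ≡ suc (2 * m) * suc (2 * t) + suc (2 * m) * suc (2 * t)
      e = solve-∀

    N≡loF+t : N ≡ 2 * m * g + suc t + t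
    N≡loF+t = e m t
      where
      e : ∀ m t → suc (2 * m) * suc (2 * t) ≡ 2 * m * suc (2 * t) + suc t + t
      e = solve-∀

    low-high-complement : (2 + 3 * m) * g + m * g ≡ n
    low-high-complement = e m t
      where
      e : ∀ m t → (2 + 3 * m) * suc (2 * t) + m * suc (2 * t) ≡ (2 + 4 * m) * suc (2 * t)
      e = solve-∀

    high-low-complement : (1 + 4 * m) * g + 1 * g ≡ n
    high-low-complement = e m t
      where
      e : ∀ m t → (1 + 4 * m) * suc (2 * t) + 1 * suc (2 * t) ≡ (2 + 4 * m) * suc (2 * t)
      e = solve-∀

    far-complement : (2 * m * g + suc t) + (N + t) ≡ n
    far-complement = e m t
      where
      e : ∀ m t → (2 * m * suc (2 * t) + suc t) + (suc (2 * m) * suc (2 * t) + t) ≡ (2 + 4 * m) * suc (2 * t)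
      e = solve-∀

    N+t<n : N + t < n
    N+t<n = <-by-difference _ (e m t)
      where
      e : ∀ m t → (2 + 4 * m) * suc (2 * t) ≡ suc (suc (2 * m) * suc (2 * t) + t + (t + 2 * m + 4 * m * t))
      e = solve-∀

    low<far : m * g < 2 * m * g + suc t
    low<far = <-by-difference _ (e m t)
      where
      e : ∀ m t → 2 * m * suc (2 * t) + suc t ≡ suc (m * suc (2 * t) + (t + m + 2 * m * t))
      e = solve-∀

    far<high : N + t < (2 + 3 * m) * g
    far<high = <-by-difference _ (e m t)
      where
      e : ∀ m t → (2 + 3 * m) * suc (2 * t) ≡ suc (suc (2 * m) * suc (2 * t) + t + (t + m + 2 * m * t))
      e = solve-∀

    high<n : (1 + 4 * m) * g < n
    high<n = <-by-difference _ (e m t)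
      where
      e : ∀ m t → (2 + 4 * m) * suc (2 * t) ≡ suc ((1 + 4 * m) * suc (2 * t) + 2 * t)
      e = solve-∀

    loF≤N : 2 * m * g + suc t ≤ N
    loF≤N = subst (2 * m * g + suc t ≤_) (sym N≡loF+t) (m≤m+n _ t)

    low<n : m * g < n
    low<n = <-≤-trans low<far (≤-trans loF≤N (≤-trans (m≤m+n N t) (<⇒≤ N+t<n)))

  class-bounds : ∀ {x} → Class x → 0 < x × x < n
  class-bounds (inj₁ (lo≤x , x≤hi))        = <-≤-trans z<s lo≤x , ≤-<-trans x≤hi low<n
  class-bounds (inj₂ (inj₁ (lo≤x , x≤hi))) = <-≤-trans z<s lo≤x , ≤-<-trans x≤hi high<n
  class-bounds (inj₂ (inj₂ (lo≤x , x≤hi))) = <-≤-trans z<s lo≤x , ≤-<-trans x≤hi N+t<n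

  far-negate : ∀ {x} → Far x → Far (n ∸ x)
  far-negate = ∈[]-negate far-complement (trans (+-comm (N + t) _) far-complement)

  class-negate : ∀ {x} → Class x → Class (n ∸ x)
  class-negate (inj₁ lx)        = inj₂ (inj₁ (∈[]-negate low-high-complement high-low-complement lx))
  class-negate (inj₂ (inj₁ hx)) = inj₁ (∈[]-negate (trans (+-comm (1 * g) _) high-low-complement)
                                                   (trans (+-comm (m * g) _) low-high-complement) hx)
  class-negate (inj₂ (inj₂ fx)) = inj₂ (inj₂ (far-negate fx))

  private
    sum-FLL : ∀ {u v w} → Far u → Low v → Low w → (u + v + w) % n ≢ 0
    sum-FLL fu xv xw = %≢0-between 0 (∈[]-+ (∈[]-+ fu xv) xw) (<-by-difference _ (lo-gap m t)) (<-by-difference _ (hi-gap m t))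
      where
      lo-gap : ∀ m t → (2 * m * suc (2 * t) + suc t) + 1 * suc (2 * t) + 1 * suc (2 * t)
                     ≡ suc (0 * ((2 + 4 * m) * suc (2 * t)) + (2 + 5 * t + 2 * m + 4 * m * t))
      lo-gap = solve-∀
      hi-gap : ∀ m t → 1 * ((2 + 4 * m) * suc (2 * t))
                     ≡ suc ((suc (2 * m) * suc (2 * t) + t) + m * suc (2 * t) + m * suc (2 * t) + (t))
      hi-gap = solve-∀

    sum-FLH : ∀ {u v w} → Far u → Low v → High w → (u + v + w) % n ≢ 0
    sum-FLH fu xv xw = %≢0-between 1 (∈[]-+ (∈[]-+ fu xv) xw) (<-by-difference _ (lo-gap m t)) (<-by-difference _ (hi-gap m t))
      where
      lo-gap : ∀ m t → (2 * m * suc (2 * t) + suc t) + 1 * suc (2 * t) + (2 + 3 * m) * suc (2 * t)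
                     ≡ suc (1 * ((2 + 4 * m) * suc (2 * t)) + (1 + 3 * t + m + 2 * m * t))
      lo-gap = solve-∀
      hi-gap : ∀ m t → 2 * ((2 + 4 * m) * suc (2 * t))
                     ≡ suc ((suc (2 * m) * suc (2 * t) + t) + m * suc (2 * t) + (1 + 4 * m) * suc (2 * t) + (1 + 3 * t + m + 2 * m * t))
      hi-gap = solve-∀

    sum-FLF : ∀ {u v w} → Far u → Low v → Far w → (u + v + w) % n ≢ 0
    sum-FLF fu xv xw = %≢0-between 1 (∈[]-+ (∈[]-+ fu xv) xw) (<-by-difference _ (lo-gap m t)) (<-by-difference _ (hi-gap m t))
      where
      lo-gap : ∀ m t → (2 * m * suc (2 * t) + suc t) + 1 * suc (2 * t) + (2 * m * suc (2 * t) + suc t)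
                     ≡ suc (1 * ((2 + 4 * m) * suc (2 * t)) + (0))
      lo-gap = solve-∀
      hi-gap : ∀ m t → 2 * ((2 + 4 * m) * suc (2 * t))
                     ≡ suc ((suc (2 * m) * suc (2 * t) + t) + m * suc (2 * t) + (suc (2 * m) * suc (2 * t) + t)
                            + (1 + 2 * t + 3 * m + 6 * m * t))
      hi-gap = solve-∀

    sum-FHH : ∀ {u v w} → Far u → High v → High w → (u + v + w) % n ≢ 0
    sum-FHH fu xv xw = %≢0-between 2 (∈[]-+ (∈[]-+ fu xv) xw) (<-by-difference _ (lo-gap m t)) (<-by-difference _ (hi-gap m t))
      where
      lo-gap : ∀ m t → (2 * m * suc (2 * t) + suc t) + (2 + 3 * m) * suc (2 * t) + (2 + 3 * m) * suc (2 * t)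
                     ≡ suc (2 * ((2 + 4 * m) * suc (2 * t)) + (t))
      lo-gap = solve-∀
      hi-gap : ∀ m t → 3 * ((2 + 4 * m) * suc (2 * t))
                     ≡ suc ((suc (2 * m) * suc (2 * t) + t) + (1 + 4 * m) * suc (2 * t) + (1 + 4 * m) * suc (2 * t)
                            + (2 + 5 * t + 2 * m + 4 * m * t))
      hi-gap = solve-∀

    sum-FHF : ∀ {u v w} → Far u → High v → Far w → (u + v + w) % n ≢ 0
    sum-FHF fu xv xw = %≢0-between 1 (∈[]-+ (∈[]-+ fu xv) xw) (<-by-difference _ (lo-gap m t)) (<-by-difference _ (hi-gap m t))
      where
      lo-gap : ∀ m t → (2 * m * suc (2 * t) + suc t) + (2 + 3 * m) * suc (2 * t) + (2 * m * suc (2 * t) + suc t)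
                     ≡ suc (1 * ((2 + 4 * m) * suc (2 * t)) + (1 + 2 * t + 3 * m + 6 * m * t))
      lo-gap = solve-∀
      hi-gap : ∀ m t → 2 * ((2 + 4 * m) * suc (2 * t))
                     ≡ suc ((suc (2 * m) * suc (2 * t) + t) + (1 + 4 * m) * suc (2 * t) + (suc (2 * m) * suc (2 * t) + t) + (0))
      hi-gap = solve-∀

    -- The only case that needs m ≥ 1, which is why m is written as suc l.
    sum-FFF : ∀ {u v w} → Far u → Far v → Far w → (u + v + w) % n ≢ 0
    sum-FFF fu xv xw = %≢0-between 1 (∈[]-+ (∈[]-+ fu xv) xw)
      (<-by-difference _ (lo-gap (k + p) t)) (<-by-difference _ (hi-gap (k + p) t))
      where
      lo-gap : ∀ l t → (2 * suc l * suc (2 * t) + suc t) + (2 * suc l * suc (2 * t) + suc t) + (2 * suc l * suc (2 * t) + suc t)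
                     ≡ suc (1 * ((2 + 4 * suc l) * suc (2 * t)) + (2 + 3 * t + 2 * l + 4 * l * t))
      lo-gap = solve-∀
      hi-gap : ∀ l t → 2 * ((2 + 4 * suc l) * suc (2 * t))
                     ≡ suc ((suc (2 * suc l) * suc (2 * t) + t) + (suc (2 * suc l) * suc (2 * t) + t)
                            + (suc (2 * suc l) * suc (2 * t) + t) + (2 + 3 * t + 2 * l + 4 * l * t))
      hi-gap = solve-∀

    flip-last : ∀ {A B : ℕ → Set} → (∀ {u v w} → Far u → A v → B w → (u + v + w) % n ≢ 0) →
                ∀ {u v w} → Far u → B v → A w → (u + v + w) % n ≢ 0
    flip-last sum-free {u} {v} {w} fu bv aw = sum-free fu aw bv ∘ subst (λ s → s % n ≡ 0) (swap u v w)
      where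
      swap : ∀ u v w → u + v + w ≡ u + w + v
      swap = solve-∀

  far-zero-sum-free : ∀ {u v w} → Far u → Class v → Class w → (u + v + w) % n ≢ 0
  far-zero-sum-free fu (inj₁ lv)        (inj₁ lw)        = sum-FLL fu lv lw
  far-zero-sum-free fu (inj₁ lv)        (inj₂ (inj₁ hw)) = sum-FLH fu lv hw
  far-zero-sum-free fu (inj₁ lv)        (inj₂ (inj₂ fw)) = sum-FLF fu lv fw
  far-zero-sum-free fu (inj₂ (inj₁ hv)) (inj₁ lw)        = flip-last sum-FLH fu hv lw
  far-zero-sum-free fu (inj₂ (inj₁ hv)) (inj₂ (inj₁ hw)) = sum-FHH fu hv hw
  far-zero-sum-free fu (inj₂ (inj₁ hv)) (inj₂ (inj₂ fw)) = sum-FHF fu hv fw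
  far-zero-sum-free fu (inj₂ (inj₂ fv)) (inj₁ lw)        = flip-last sum-FLF fu fv lw
  far-zero-sum-free fu (inj₂ (inj₂ fv)) (inj₂ (inj₁ hw)) = flip-last sum-FHF fu fv hw
  far-zero-sum-free fu (inj₂ (inj₂ fv)) (inj₂ (inj₂ fw)) = sum-FFF fu fv fw

  unlinked : ∀ {x d y} → Class x → Class d → Class y → Far x ⊎ Far d ⊎ Far y → (x + d) % n ≢ y
  unlinked {x} {d} {y} cx cd cy far x+d≡y = case far
    where
    y≤n : y ≤ n
    y≤n = <⇒≤ (proj₂ (class-bounds cy))
    zero-sum : (x + d + (n ∸ y)) % n ≡ 0
    zero-sum = begin
      (x + d + (n ∸ y)) % n       ≡⟨ sym ([m%n+o]%n≡[m+o]%n (x + d) (n ∸ y)) ⟩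
      ((x + d) % n + (n ∸ y)) % n ≡⟨ cong (λ z → (z + (n ∸ y)) % n) x+d≡y ⟩
      (y + (n ∸ y)) % n           ≡⟨ cong (_% n) (m+[n∸m]≡n y≤n) ⟩
      n % n                       ≡⟨ n%n≡0 n ⟩
      0                           ∎
      where open ≡-Reasoning
    rotate : ∀ a b c → a + b + c ≡ b + c + a
    rotate = solve-∀
    case : Far x ⊎ Far d ⊎ Far y → ⊥
    case (inj₁ fx)        = far-zero-sum-free fx cd (class-negate cy) zero-sum
    case (inj₂ (inj₁ fd)) = far-zero-sum-free fd (class-negate cy) cx (trans (cong (_% n) (sym (rotate x d (n ∸ y)))) zero-sum)
    case (inj₂ (inj₂ fy)) = far-zero-sum-free (far-negate fy) cx cd (trans (cong (_% n) (rotate (n ∸ y) x d)) zero-sum)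

  D₀ lower upper far D S : List ℕ
  D₀    = P ++ map (K ∸_) P
  lower = map (N ∸_) (range 1 t)
  upper = map (N +_) (range 1 t)
  far   = lower ++ upper ++ optional b N
  D     = map (_* g) D₀ ++ far
  S     = map (_* g) P ++ lower ++ optional b N

  private
    loF : ℕ
    loF = 2 * m * g + suc t

    3m<K : 3 * m < K
    3m<K = <-by-difference (suc m) (e m)
      where
      e : ∀ m → 2 + 4 * m ≡ suc (3 * m + suc m)
      e = solve-∀

    m≤K : m ≤ K
    m≤K = ≤-trans (m≤m+n m _) (m≤n+m _ 2)

    t≤N : t ≤ N
    t≤N = subst (t ≤_) (sym N≡loF+t) (m≤n+m t _)

    ∈[]-*ʳ : ∀ {x lo hi} → x ∈[ lo , hi ] → (x * g) ∈[ lo * g , hi * g ]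
    ∈[]-*ʳ (lo≤x , x≤hi) = *-monoˡ-≤ g lo≤x , *-monoˡ-≤ g x≤hi

    negP-bounds : All (λ x → x ∈[ 2 + 3 * m , 1 + 4 * m ]) (map (K ∸_) P)
    negP-bounds = All.map⁺ (All.map (∈[]-negate (e₁ m) (e₂ m)) P-bounds)
      where
      e₁ : ∀ m → 2 + 3 * m + m ≡ 2 + 4 * m
      e₁ = solve-∀
      e₂ : ∀ m → 1 + 4 * m + 1 ≡ 2 + 4 * m
      e₂ = solve-∀

    low-part : All Low (map (_* g) P)
    low-part = All.map⁺ (All.map ∈[]-*ʳ P-bounds)

    near-class : All (λ x → Low x ⊎ High x) (map (_* g) D₀)
    near-class = All.map⁺ (All.++⁺ (All.map (inj₁ ∘ ∈[]-*ʳ) P-bounds) (All.map (inj₂ ∘ ∈[]-*ʳ) negP-bounds))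

    lower-far : All Far lower
    lower-far = All.map⁺ (All.map (λ {i} (_ , i<1+t) →
        m+n≤o⇒m≤o∸n loF (subst (loF + i ≤_) (sym N≡loF+t) (+-monoʳ-≤ loF (≤-pred i<1+t))) ,
        ≤-trans (m∸n≤m N i) (m≤m+n N t))
      (range-bounds 1 t))

    upper-far : All Far upper
    upper-far = All.map⁺ (All.map (λ (_ , i<1+t) → ≤-trans loF≤N (m≤m+n N _) , +-monoʳ-≤ N (≤-pred i<1+t))
                                  (range-bounds 1 t))

    N-far : Far N
    N-far = loF≤N , m≤m+n N t

    far-class : All Far far
    far-class = All.++⁺ lower-far (All.++⁺ upper-far (All-optional b N-far))

    near-inside : All Class (map (_* g) D₀)
    near-inside = All.map [ inj₁ , inj₂ ∘ inj₁ ]′ near-class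

    far-inside : All (λ x → Class x × Far x) far
    far-inside = All.map (λ fx → inj₂ (inj₂ fx) , fx) far-class

    D-class : All Class D
    D-class = All.++⁺ near-inside (All.map proj₁ far-inside)

    S-class : All Class S
    S-class = All.++⁺ (All.map inj₁ low-part) (All.map (inj₂ ∘ inj₂) (All.++⁺ lower-far (All-optional b N-far)))

    D₀-unique : Unique D₀
    D₀-unique = Unique.++⁺ P-unique
      (Unique-map-on (λ (_ , a≤m) (_ , b≤m) → ∸-cancelˡ-≡ (≤-trans a≤m m≤K) (≤-trans b≤m m≤K)) P-bounds P-unique)
      (disjoint-by P-bounds negP-bounds (λ (_ , a≤m) (lo≤a , _) → <⇒≱ m<2+3m (≤-trans lo≤a a≤m)))
      where
      m<2+3m : m < 2 + 3 * m
      m<2+3m = s≤s (≤-trans (m≤m+n m _) (n≤1+n _))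

    far-unique : Unique far
    far-unique = Unique.++⁺ lower-unique (Unique.++⁺ upper-unique (optional-unique b N) upper∩mid) lower∩rest
      where
      i≤N : ∀ {i} → 1 ≤ i × i < 1 + t → i ≤ N
      i≤N (_ , i<1+t) = ≤-trans (≤-pred i<1+t) t≤N
      lower-unique : Unique lower
      lower-unique = Unique-map-on (λ ri rj → ∸-cancelˡ-≡ (i≤N ri) (i≤N rj)) (range-bounds 1 t) (range-unique 1 t)
      upper-unique : Unique upper
      upper-unique = Unique.map⁺ (+-cancelˡ-≡ N _ _) (range-unique 1 t)
      upper∩mid : Disjoint upper (optional b N)
      upper∩mid = disjoint-by {P = N <_} {Q = _≡ N}
                              (All.map⁺ (All.map (λ (1≤i , _) → m<m+n N 1≤i) (range-bounds 1 t))) (All-optional b refl)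
                              (λ N<x x≡N → <⇒≢ N<x (sym x≡N))
      lower∩rest : Disjoint lower (upper ++ optional b N)
      lower∩rest = disjoint-by {P = _< N} {Q = N ≤_}
                               (All.map⁺ (All.map (λ ri@(1≤i , _) → ∸-monoʳ-< 1≤i (i≤N ri)) (range-bounds 1 t)))
                               (All.++⁺ (All.map⁺ (All.universal (λ i → m≤m+n N i) (range 1 t))) (All-optional b ≤-refl))
                               (λ x<N N≤x → <⇒≱ x<N N≤x)

    D-unique : Unique D
    D-unique = Unique.++⁺ (Unique.map⁺ (λ {x} {y} → *-cancelʳ-≡ x y g) D₀-unique) far-unique
      (disjoint-by near-class far-class separated)
      where
      separated : ∀ {x} → Low x ⊎ High x → Far x → ⊥
      separated (inj₁ (_ , x≤mg)) (loF≤x , _) = <⇒≱ low<far (≤-trans loF≤x x≤mg)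
      separated (inj₂ (lo≤x , _)) (_ , x≤hi)  = <⇒≱ far<high (≤-trans lo≤x x≤hi)

    same-elements : ∀ q → any q D ≡ any q (S ++ map (n ∸_) S)
    same-elements q = begin
      any q D
        ≡⟨ cong (any q) (cong (_++ far) (map-++ (_* g) P (map (K ∸_) P))) ⟩
      any q ((A ++ B) ++ lower ++ upper ++ M)
        ≡⟨ trans (any-++ q (A ++ B) _)
                 (cong₂ _∨_ (any-++ q A B) (trans (any-++ q lower _) (cong (any q lower ∨_) (any-++ q upper M)))) ⟩
      (any q A ∨ any q B) ∨ (any q lower ∨ (any q upper ∨ any q M))
        ≡⟨ ∨-shuffle (any q A) (any q B) (any q lower) (any q upper) (any q M) ⟩
      (any q A ∨ (any q lower ∨ any q M)) ∨ (any q B ∨ (any q upper ∨ any q M))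
        ≡⟨ sym (trans (any-++ q S _) (cong₂ _∨_ (trans (any-++ q A _) (cong (any q A ∨_) (any-++ q lower M)))
                 (trans (cong (any q) negated-S) (trans (any-++ q B _) (cong (any q B ∨_) (any-++ q upper M)))))) ⟩
      any q (S ++ map (n ∸_) S) ∎
      where
      open ≡-Reasoning
      A B M : List ℕ
      A = map (_* g) P
      B = map (_* g) (map (K ∸_) P)
      M = optional b N
      ∨-shuffle : ∀ a b l u c → (a ∨ b) ∨ (l ∨ (u ∨ c)) ≡ (a ∨ (l ∨ c)) ∨ (b ∨ (u ∨ c))
      ∨-shuffle = ICM.solve 5 (λ a b l u c → (a ICM.⊕ b) ICM.⊕ (l ICM.⊕ (u ICM.⊕ c))
                                   ICM.⊜ (a ICM.⊕ (l ICM.⊕ c)) ICM.⊕ (b ICM.⊕ (u ICM.⊕ c))) refl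
      negated-A : map (n ∸_) A ≡ B
      negated-A = trans (sym (map-∘ P)) (trans (map-cong (λ a → sym (*-distribʳ-∸ g K a)) P) (map-∘ P))
      negated-lower : map (n ∸_) lower ≡ upper
      negated-lower = trans (sym (map-∘ (range 1 t))) (map-cong-local (All.map (λ {i} (_ , i<1+t) → begin
        n ∸ (N ∸ i)         ≡⟨ cong (_∸ (N ∸ i)) n≡N+N ⟩
        N + N ∸ (N ∸ i)     ≡⟨ +-∸-assoc N (m∸n≤m N i) ⟩
        N + (N ∸ (N ∸ i))   ≡⟨ cong (N +_) (m∸[m∸n]≡n (≤-trans (≤-pred i<1+t) t≤N)) ⟩
        N + i               ∎) (range-bounds 1 t)))
      negated-M : map (n ∸_) M ≡ M
      negated-M = trans (map-optional (n ∸_) b N) (cong (optional b) (trans (cong (_∸ N) n≡N+N) (m+n∸n≡m N N)))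
      negated-S : map (n ∸_) S ≡ B ++ upper ++ M
      negated-S = trans (map-++ (n ∸_) A _)
        (cong₂ _++_ negated-A (trans (map-++ (n ∸_) lower M) (cong₂ _++_ negated-lower negated-M)))

    length-D : length D ≡ 2 * suc k + (t + (t + ⟦ b ⟧))
    length-D = begin
      length D
        ≡⟨ length-++ (map (_* g) D₀) ⟩
      length (map (_* g) D₀) + length far
        ≡⟨ cong₂ _+_ (trans (length-map _ D₀) (trans (length-++ P) (cong (length P +_) (length-map _ P))))
                     (trans (length-++ lower) (cong₂ _+_ length-range-map
                       (trans (length-++ upper) (cong₂ _+_ length-range-map (length-optional b N))))) ⟩
      length P + length P + (t + (t + ⟦ b ⟧))
        ≡⟨ cong (λ l → l + l + (t + (t + ⟦ b ⟧))) length-P ⟩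
      (k + 1) + (k + 1) + (t + (t + ⟦ b ⟧))
        ≡⟨ cong (_+ (t + (t + ⟦ b ⟧))) (double-suc k) ⟩
      2 * suc k + (t + (t + ⟦ b ⟧)) ∎
      where
      open ≡-Reasoning
      length-range-map : ∀ {f : ℕ → ℕ} → length (map f (range 1 t)) ≡ t
      length-range-map = trans (length-map _ (range 1 t)) (length-range 1 t)
      length-P : length P ≡ k + 1
      length-P = trans (length-++ (range 1 k)) (cong (_+ 1) (length-range 1 k))
      double-suc : ∀ k → (k + 1) + (k + 1) ≡ 2 * suc k
      double-suc = solve-∀

    S≤N : All (_≤ N) S
    S≤N = All.++⁺ (All.map (λ (_ , x≤mg) → ≤-trans x≤mg (≤-trans (<⇒≤ low<far) loF≤N)) low-part)
                  (All.++⁺ (All.map⁺ (All.universal (λ i → m∸n≤m N i) (range 1 t))) (All-optional b ≤-refl))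

    n/2≡N : n / 2 ≡ N
    n/2≡N = trans (cong (_/ 2) (trans n≡N+N (m+m≡m*2 N))) (m*n/n≡m N 2)

    valid : ValidConn n S
    valid = All.zipWith (λ {x} (cx , x≤N) → proj₁ (class-bounds cx) , subst (x ≤_) (sym n/2≡N) x≤N) (S-class , S≤N)

    linked : linkedPairs n D ≡ 3 * (k C 2 + j) * 2
    linked = begin
      linkedPairs n D                 ≡⟨ linkedPairs-++-unlinked unlinked near-inside far-inside ⟩
      linkedPairs n (map (_* g) D₀)   ≡⟨ linkedPairs-scale K g D₀ ⟩
      linkedPairs K D₀                ≡⟨ linkedPairs-± P-unique P-bounds 3m<K ⟩
      6 * schurPairs P                ≡⟨ cong (6 *_) schurPairs-P ⟩
      6 * (k C 2 + j)                 ≡⟨ *-assoc 3 2 (k C 2 + j) ⟩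
      3 * (2 * (k C 2 + j))           ≡⟨ cong (3 *_) (*-comm 2 (k C 2 + j)) ⟩
      3 * ((k C 2 + j) * 2)           ≡⟨ sym (*-assoc 3 (k C 2 + j) 2) ⟩
      3 * (k C 2 + j) * 2             ∎
      where open ≡-Reasoning

  rcCirculant : ValidConn n S × IsRCCirc n S (2 * suc k + (t + (t + ⟦ b ⟧))) (3 * (k C 2 + j))
  rcCirculant = valid , isRCCirc length-D linked
    where
    S≤n : All (_≤ n) S
    S≤n = All.map (λ cx → <⇒≤ (proj₂ (class-bounds cx))) S-class
    open CayleyCount S D (circAdjℕ≡cayleyAdj {S = S} {D = D} S≤n same-elements) D-unique (All.map class-bounds D-class)

RCCirculantExists-intro : ∀ {n} .{{_ : NonZero n}} {S r c} → 2 ≤ n → ValidConn n S × IsRCCirc n S r c → RCCirculantExists r c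
RCCirculantExists-intro {suc (suc m′)} (s≤s (s≤s z≤n)) circ = m′ , _ , circ

segmentCirculantExists : ∀ p j t b → RCCirculantExists (2 * suc (p + j) + (t + (t + ⟦ b ⟧))) (3 * ((p + j) C 2 + j))
segmentCirculantExists p j t b = RCCirculantExists-intro (≤-trans (s≤s (s≤s z≤n)) (m≤m*n K g)) rcCirculant
  where open Construction p j t b

halve : ∀ r → Σ ℕ λ t → Σ Bool λ b → r ≡ t + (t + ⟦ b ⟧)
halve zero          = 0 , false , refl
halve (suc zero)    = 0 , true , refl
halve (suc (suc r)) with halve r
... | t , b , r≡ = suc t , b , trans (cong (2 +_) r≡) (cong suc (sym (+-suc t (t + ⟦ b ⟧))))

kC2≤q≤kC2+k : ∀ k q → 3 * ((k ∸ 1) * k) ≤ 2 * (q * 3) → 2 * (q * 3) ≤ 3 * (suc k * k) → k C 2 ≤ q × q ≤ k C 2 + k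
kC2≤q≤kC2+k k q lower upper =
  cancel (subst₂ _≤_ (cong (3 *_) [k∸1]k≡2kC2) (6q≡ q) lower) ,
  cancel (subst₂ _≤_ (6q≡ q) (cong (3 *_) [k+1]k≡2[kC2+k]) upper)
  where
  cancel : ∀ {x y} → 3 * (2 * x) ≤ 3 * (2 * y) → x ≤ y
  cancel 6x≤6y = *-cancelˡ-≤ 2 (*-cancelˡ-≤ 3 6x≤6y)
  6q≡ : ∀ q → 2 * (q * 3) ≡ 3 * (2 * q)
  6q≡ = solve-∀
  [k∸1]k≡2kC2 : (k ∸ 1) * k ≡ 2 * (k C 2)
  [k∸1]k≡2kC2 = trans (*-comm (k ∸ 1) k) (sym (2*[lC2] k))
  [k+1]k≡2[kC2+k] : suc k * k ≡ 2 * (k C 2 + k)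
  [k+1]k≡2[kC2+k] = trans (sym (2*[lC2] (suc k))) (cong (2 *_) (trans ([1+l]C2 k) (+-comm k (k C 2))))

proposition3p6 : (k c r : ℕ) → 1 ≤ k → 2 * k ≤ r → 3 ∣ c
    → 3 * ((k ∸ 2) * (k ∸ 1)) ≤ 2 * c → 2 * c ≤ 3 * (k * (k ∸ 1))
    → RCCirculantExists r c
proposition3p6 (suc k) c r _ 2k+2≤r (divides q refl) lower upper with halve (r ∸ 2 * suc k)
... | t , b , rest≡ = subst₂ RCCirculantExists r≡ c≡ (segmentCirculantExists (k ∸ j) j t b)
  where
  j : ℕ
  j = q ∸ k C 2
  q-bounds : k C 2 ≤ q × q ≤ k C 2 + k
  q-bounds = kC2≤q≤kC2+k k q lower upper
  k∸j+j≡k : k ∸ j + j ≡ k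
  k∸j+j≡k = m∸n+n≡m (subst (j ≤_) (m+n∸m≡n (k C 2) k) (∸-monoˡ-≤ (k C 2) (proj₂ q-bounds)))
  r≡ : 2 * suc (k ∸ j + j) + (t + (t + ⟦ b ⟧)) ≡ r
  r≡ = begin
    2 * suc (k ∸ j + j) + (t + (t + ⟦ b ⟧))  ≡⟨ cong (λ l → 2 * suc l + (t + (t + ⟦ b ⟧))) k∸j+j≡k ⟩
    2 * suc k + (t + (t + ⟦ b ⟧))            ≡⟨ cong (2 * suc k +_) (sym rest≡) ⟩
    2 * suc k + (r ∸ 2 * suc k)              ≡⟨ m+[n∸m]≡n 2k+2≤r ⟩
    r                                        ∎
    where open ≡-Reasoning
  c≡ : 3 * ((k ∸ j + j) C 2 + j) ≡ q * 3
  c≡ = begin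
    3 * ((k ∸ j + j) C 2 + j)  ≡⟨ cong (λ l → 3 * (l C 2 + j)) k∸j+j≡k ⟩
    3 * (k C 2 + j)            ≡⟨ cong (3 *_) (m+[n∸m]≡n (proj₁ q-bounds)) ⟩
    3 * q                      ≡⟨ *-comm 3 q ⟩
    q * 3                      ∎
    where open ≡-Reasoning
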